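{- For $t \ge 1$ let $B^*_t(q) := \sum_{n \geq 1} b^*_t(n) q^n$, where $b^*_t(n) := \sum_{\lambda \in \mathcal{DO}(n)} n_t(\lambda)$. Then, as formal power series in $q$: for $t \geq 2$ even, \begin{align*} B^*_t(q) &= (-q; q^2)_\infty \sum_{k = 0}^{\lfloor (t-4)/6 \rfloor} q^{t+4k^2+2k} \binom{\frac{t-2k-2}{2}}{2k+1}_{q^2} \sum_{m \geq 0} \frac{q^{2m(2k+2)}}{(-q^{2m+1}; q^2)_{\frac{t-2k}{2}}} \\ &\quad+ (-q; q^2)_\infty \sum_{k=0}^{\lfloor (t-2)/6 \rfloor} q^{t+ 4k^2 + 2k + 1} \binom{\frac{t-2k-2}{2}}{2k}_{q^2} \sum_{m \geq 0} \frac{q^{2m(2k+1)}}{(-q^{2m+3}; q^2)_{\frac{t-2k}{2}}}, \end{align*} and for $t \geq 1$ odd, \begin{align*} B^*_t(q) &= (-q; q^2)_\infty \sum_{k = 0}^{\lfloor (t-1)/6 \rfloor} q^{t+4k^2-2k} \binom{\frac{t-2k-1}{2}}{2k}_{q^2} \sum_{m \geq 0} \frac{q^{2m(2k+1)}}{(-q^{2m+1}; q^2)_{\frac{t-2k+1}{2}}} \\ &\quad+ (-q; q^2)_\infty \sum_{k=0}^{\lfloor (t-5)/6 \rfloor} q^{t+ 4k^2 + 6k + 3} \binom{\frac{t-2k-3}{2}}{2k+1}_{q^2} \sum_{m \geq 0} \frac{q^{2m(2k+2)}}{(-q^{2m+3}; q^2)_{\frac{t-2k-1}{2}}}. \end{align*}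 (Empty sums are $0$.)
   Context: A partition $\lambda$ of $n$ is a non-increasing sequence of positive integers summing to $n$, drawn as a Ferrers–Young diagram of left-justified rows. The hook number of a box is the number of boxes to its right in its row, plus the number of boxes below it in its column, plus one. $n_t(\lambda)$ is the number of boxes of $\lambda$ with hook number exactly $t$; $\mathcal{DO}(n)$ is the set of partitions of $n$ into distinct odd parts. Notation: $(x;q)_0 := 1$, $(x;q)_n := \prod_{i=0}^{n-1}(1-xq^i)$, $(x;q)_\infty := \lim_{n\to\infty}(x;q)_n$, and the $q$-binomial coefficient is $\binom{n}{k}_q := \frac{(q;q)_n}{(q;q)_k (q;q)_{n-k}}$ for $0\le k\le n$ (and $0$ if $k > n$). -}

module Defs where

open import Data.Nat as ℕ using (ℕ; zero; suc; _≤ᵇ_; _≡ᵇ_; _<ᵇ_; _%_; _/_; _∸_)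
open import Data.Integer as ℤ using (ℤ; +_; -_; 0ℤ; 1ℤ)
open import Data.Bool using (Bool; true; false; if_then_else_)
open import Data.List using (List; []; _∷_; length; filter; map)
open import Data.Nat.ListAction using (sum)
open import Data.List.Relation.Unary.All using (All)
open import Data.List.Relation.Unary.Linked using (Linked)
open import Data.List.Relation.Unary.Unique.Propositional using (Unique)
open import Data.List.Membership.Propositional using (_∈_)
open import Data.Product using (_×_)
open import Function.Bundles using (_⇔_)
open import Relation.Binary.PropositionalEquality using (_≡_)

-- A partition is the list of its row lengths (λ₁, λ₂, …).
-- λ ∈ DO(n): strictly decreasing (= non-increasing with distinct parts),
-- all parts odd (hence positive), summing to n.
IsDO : ℕ → List ℕ → Set
IsDO n p = Linked ℕ._>_ p × All (λ x → x % 2 ≡ 1) p × sum p ≡ n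

-- leg length of column j below a row: number of later rows longer than j
legBelow : List ℕ → ℕ → ℕ
legBelow rest j = length (filter (λ r → j ℕ.<? r) rest)

countRow : ℕ → ℕ → List ℕ → ℕ → ℕ
countRow t r rest zero = 0
countRow t r rest (suc j) =
  countRow t r rest j
  ℕ.+ (if (r ∸ j ∸ 1) ℕ.+ legBelow rest j ℕ.+ 1 ≡ᵇ t then 1 else 0)

nHook : ℕ → List ℕ → ℕ
nHook t [] = 0
nHook t (r ∷ rest) = countRow t r rest r ℕ.+ nHook t rest

FPS : Set
FPS = ℕ → ℤ

sumTo : ℕ → (ℕ → ℤ) → ℤ
sumTo zero f = 0ℤ
sumTo (suc n) f = sumTo n f ℤ.+ f n

zeroS : FPS
zeroS _ = 0ℤ

mono : ℕ → FPS
mono a N = if N ≡ᵇ a then 1ℤ else 0ℤ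

oneS : FPS
oneS = mono 0

_⊕_ : FPS → FPS → FPS
(f ⊕ g) N = f N ℤ.+ g N

_⊖_ : FPS → FPS → FPS
(f ⊖ g) N = f N ℤ.- g N

_⊛_ : FPS → FPS → FPS
(f ⊛ g) N = sumTo (suc N) (λ i → f i ℤ.* g (N ∸ i))

infixl 7 _⊛_
infixl 6 _⊕_ _⊖_

prodTo : ℕ → (ℕ → FPS) → FPS
prodTo zero F = oneS
prodTo (suc n) F = prodTo n F ⊛ F n

-- multiplicative inverse of a series with constant term 1:
-- b₀ = 1, b_N = - Σ_{i=1}^{N} a_i b_{N-i}.
-- invRev a N = [b_N, b_{N-1}, …, b_0]
nth : List ℤ → ℕ → ℤ
nth [] _ = 0ℤ
nth (x ∷ xs) zero = x
nth (x ∷ xs) (suc i) = nth xs i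

invRev : FPS → ℕ → List ℤ
invRev a zero = 1ℤ ∷ []
invRev a (suc N) =
  (ℤ.- sumTo (suc N) (λ i → a (suc i) ℤ.* nth (invRev a N) i)) ∷ invRev a N

inv : FPS → FPS
inv a N = nth (invRev a N) 0

poch : FPS → ℕ → ℕ → FPS
poch x d n = prodTo n (λ i → oneS ⊖ x ⊛ mono (d ℕ.* i))

-- (x; q^d)_∞ , for x of order ≥ 1 and d ≥ 1: the coefficient of q^N
-- only depends on the first N+1 factors.
pochInf : FPS → ℕ → FPS
pochInf x d N = poch x d (suc N) N

negMono : ℕ → FPS
negMono a N = ℤ.- mono a N

qbin2 : ℕ → ℕ → FPS
qbin2 n k =
  if k ≤ᵇ n
  then poch (mono 2) 2 n ⊛ inv (poch (mono 2) 2 k ⊛ poch (mono 2) 2 (n ∸ k))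
  else zeroS

-- Σ_{m≥0} F m, for families where F m has order ≥ m+1 whenever m ≥ 1
-- (true for all uses below: the m-th term has order ≥ 2m), so the
-- coefficient of q^N is Σ_{m≤N} [q^N] F m.
mSum : (ℕ → FPS) → FPS
mSum F N = sumTo (suc N) (λ m → F m N)

-- Σ_{k=0}^{K} F k, where the range 0 ≤ k ≤ K is given by a Boolean test
-- cond k (k ≤ ⌊(t-c)/6⌋ ⇔ 6k + c ≤ t); k never exceeds t.
sumK : ℕ → (ℕ → Bool) → (ℕ → FPS) → FPS
sumK t cond F N = sumTo (suc t) (λ k → if cond k then F k N else 0ℤ)

rhsEven : ℕ → FPS
rhsEven t =
  pochInf (negMono 1) 2 ⊛
    sumK t (λ k → 6 ℕ.* k ℕ.+ 4 ≤ᵇ t) (λ k →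
      mono (t ℕ.+ 4 ℕ.* k ℕ.* k ℕ.+ 2 ℕ.* k)
      ⊛ qbin2 ((t ∸ 2 ℕ.* k ∸ 2) / 2) (2 ℕ.* k ℕ.+ 1)
      ⊛ mSum (λ m → mono (2 ℕ.* m ℕ.* (2 ℕ.* k ℕ.+ 2))
                    ⊛ inv (poch (negMono (2 ℕ.* m ℕ.+ 1)) 2 ((t ∸ 2 ℕ.* k) / 2))))
  ⊕
  pochInf (negMono 1) 2 ⊛
    sumK t (λ k → 6 ℕ.* k ℕ.+ 2 ≤ᵇ t) (λ k →
      mono (t ℕ.+ 4 ℕ.* k ℕ.* k ℕ.+ 2 ℕ.* k ℕ.+ 1)
      ⊛ qbin2 ((t ∸ 2 ℕ.* k ∸ 2) / 2) (2 ℕ.* k)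
      ⊛ mSum (λ m → mono (2 ℕ.* m ℕ.* (2 ℕ.* k ℕ.+ 1))
                    ⊛ inv (poch (negMono (2 ℕ.* m ℕ.+ 3)) 2 ((t ∸ 2 ℕ.* k) / 2))))

-- note: t + 4k² - 2k is written (t + 4k²) ∸ 2k, which is exact since 2k ≤ 4k².
rhsOdd : ℕ → FPS
rhsOdd t =
  pochInf (negMono 1) 2 ⊛
    sumK t (λ k → 6 ℕ.* k ℕ.+ 1 ≤ᵇ t) (λ k →
      mono (t ℕ.+ 4 ℕ.* k ℕ.* k ∸ 2 ℕ.* k)
      ⊛ qbin2 ((t ∸ 2 ℕ.* k ∸ 1) / 2) (2 ℕ.* k)
      ⊛ mSum (λ m → mono (2 ℕ.* m ℕ.* (2 ℕ.* k ℕ.+ 1))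
                    ⊛ inv (poch (negMono (2 ℕ.* m ℕ.+ 1)) 2 ((t ∸ 2 ℕ.* k ℕ.+ 1) / 2))))
  ⊕
  pochInf (negMono 1) 2 ⊛
    sumK t (λ k → 6 ℕ.* k ℕ.+ 5 ≤ᵇ t) (λ k →
      mono (t ℕ.+ 4 ℕ.* k ℕ.* k ℕ.+ 6 ℕ.* k ℕ.+ 3)
      ⊛ qbin2 ((t ∸ 2 ℕ.* k ∸ 3) / 2) (2 ℕ.* k ℕ.+ 1)
      ⊛ mSum (λ m → mono (2 ℕ.* m ℕ.* (2 ℕ.* k ℕ.+ 2))
                    ⊛ inv (poch (negMono (2 ℕ.* m ℕ.+ 3)) 2 ((t ∸ 2 ℕ.* k ∸ 1) / 2))))

-- "F is the series B*_t(q) = Σ_{n≥1} b*_t(n) q^n":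
-- the constant coefficient is 0, and for n ≥ 1 the coefficient of q^n equals
-- Σ_{λ ∈ DO(n)} n_t(λ), the sum taken over any duplicate-free list L
-- enumerating exactly DO(n).
IsBstar : ℕ → FPS → Set
IsBstar t F =
  (F 0 ≡ 0ℤ) ×
  (∀ (n : ℕ) → 1 ℕ.≤ n → (L : List (List ℕ)) → Unique L →
     (∀ p → (p ∈ L) ⇔ IsDO n p) →
     F n ≡ + sum (map (nHook t) L))

-- Sort the boxes of hook length t by their leg ℓ < t and their column j. Such a box lies in the row
-- of length a = j + t − ℓ, so for λ ∈ DO(n) it exists iff a is a part of λ and exactly ℓ parts of λ lie strictly
-- between j and a. Writing j = 2m + ε (ε ≤ 1) and a = 1 + 2d + 2r with d = m + ε, the generating function of
-- these λ factorises: the odd parts outside the window [1 + 2d, a] are free and give (−q; q²)_∞ divided by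
-- (−q^(1+2d); q²)_(r+1), while the window contributes q^a times the generating function of the ℓ-element
-- subsets of its r lower parts, q^(ℓ(1+2d) + ℓ(ℓ−1)) [r, ℓ]_{q²}. Pairs (ℓ, j) with a even contribute nothing;
-- the others, grouped by the parities of ℓ and t, are exactly the four sums over k, with ℓ = 2k or 2k + 1 and
-- r = (t − ℓ − 1 − ε)/2, and the terms with r < ℓ vanish. Coefficients up to q^n only see the odd parts below
-- 2K for K > n, where (−q; q²)_∞ may be replaced by (−q; q²)_K and all sums become finite.

module Submission where

open import Defs
open import Data.Nat as ℕ using (ℕ; zero; suc; z≤n; s≤s; _≤_; _<_; _>_; _∸_; _%_; _/_; _≤ᵇ_; _≡ᵇ_)
import Data.Nat.DivMod as ℕ/
import Data.Nat.Properties as ℕₚ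
open import Data.Nat.Tactic.RingSolver using (solve-∀)
open import Data.Integer as ℤ using (ℤ; 0ℤ; 1ℤ; _+_; _*_; -_; _-_)
import Data.Integer.Properties as ℤₚ
open import Data.Bool using (Bool; true; false; if_then_else_; T)
open import Data.Empty using (⊥-elim)
open import Data.Sum using (inj₁; inj₂)
open import Data.Product using (_×_; _,_)
open import Data.List using (List; []; _∷_; _++_; map; length; filter)
import Data.List.Properties as Listₚ
open import Data.Nat.ListAction using (sum)
open import Data.List.Relation.Unary.All as All using (All; []; _∷_)
open import Data.List.Relation.Unary.Any using (here; there)
open import Data.List.Relation.Unary.AllPairs using (AllPairs; []; _∷_)
import Data.List.Relation.Unary.Linked.Properties as Linkedₚ
open import Data.List.Relation.Unary.Unique.Propositional using (Unique)
import Data.List.Relation.Unary.Unique.Propositional.Properties as Uniqueₚ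
open import Data.List.Relation.Binary.Permutation.Propositional using (_↭_)
import Data.List.Relation.Binary.Permutation.Propositional.Properties as ↭ₚ
open import Data.List.Membership.Propositional.Properties.WithK using (unique∧set⇒bag)
open import Data.List.Relation.Binary.BagAndSetEquality using (∼bag⇒↭)
open import Function using (_∘_; _⇔_; mk⇔; Equivalence)
open import Data.List.Membership.Propositional using (_∈_)
import Data.List.Membership.Propositional.Properties as ∈ₚ
import Data.Nat.ListAction.Properties as sumₚ
open import Relation.Binary.PropositionalEquality
open import Relation.Nullary using (¬_; yes; no)
open import Relation.Binary.Definitions using (tri<; tri≈; tri>)
import Relation.Binary.Reasoning.Setoid as SetoidReasoning
open import Relation.Binary.Bundles using (Setoid)
open import Algebra.Bundles using (CommutativeRing)
open import Algebra.Properties.CommutativeSemigroup ℤₚ.+-commutativeSemigroup using (interchange; xy∙z≈x∙zy)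
import Algebra.Solver.Ring
import Algebra.Solver.Ring.AlmostCommutativeRing as ACR
open import Data.Maybe using (Maybe; just; nothing)

-- Finite sums

sumTo-cong-< : ∀ n {f g : ℕ → ℤ} → (∀ i → i < n → f i ≡ g i) → sumTo n f ≡ sumTo n g
sumTo-cong-< zero    f≡g = refl
sumTo-cong-< (suc n) f≡g =
  cong₂ _+_ (sumTo-cong-< n (λ i i<n → f≡g i (ℕₚ.m<n⇒m<1+n i<n))) (f≡g n ℕₚ.≤-refl)

sumTo-cong : ∀ n {f g : ℕ → ℤ} → f ≗ g → sumTo n f ≡ sumTo n g
sumTo-cong n f≗g = sumTo-cong-< n (λ i _ → f≗g i)

sumTo-zero : ∀ n {f : ℕ → ℤ} → (∀ i → i < n → f i ≡ 0ℤ) → sumTo n f ≡ 0ℤ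
sumTo-zero zero    f≡0 = refl
sumTo-zero (suc n) f≡0 =
  cong₂ _+_ (sumTo-zero n (λ i i<n → f≡0 i (ℕₚ.m<n⇒m<1+n i<n))) (f≡0 n ℕₚ.≤-refl)

sumTo-distrib-+ : ∀ n (f g : ℕ → ℤ) → sumTo n (λ i → f i + g i) ≡ sumTo n f + sumTo n g
sumTo-distrib-+ zero    f g = refl
sumTo-distrib-+ (suc n) f g =
  trans (cong (_+ (f n + g n)) (sumTo-distrib-+ n f g)) (interchange (sumTo n f) (sumTo n g) (f n) (g n))

sumTo-*ˡ : ∀ n c (f : ℕ → ℤ) → c * sumTo n f ≡ sumTo n (λ i → c * f i)
sumTo-*ˡ zero    c f = ℤₚ.*-zeroʳ c
sumTo-*ˡ (suc n) c f = trans (ℤₚ.*-distribˡ-+ c (sumTo n f) (f n)) (cong (_+ c * f n) (sumTo-*ˡ n c f))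

sumTo-*ʳ : ∀ n c (f : ℕ → ℤ) → sumTo n f * c ≡ sumTo n (λ i → f i * c)
sumTo-*ʳ n c f =
  trans (ℤₚ.*-comm (sumTo n f) c) (trans (sumTo-*ˡ n c f) (sumTo-cong n (λ i → ℤₚ.*-comm c (f i))))

sumTo-head : ∀ n (f : ℕ → ℤ) → sumTo (suc n) f ≡ f 0 + sumTo n (λ i → f (suc i))
sumTo-head zero    f = trans (ℤₚ.+-identityˡ (f 0)) (sym (ℤₚ.+-identityʳ (f 0)))
sumTo-head (suc n) f = trans (cong (_+ f (suc n)) (sumTo-head n f)) (ℤₚ.+-assoc (f 0) _ _)

sumTo-reverse : ∀ n (f : ℕ → ℤ) → sumTo n f ≡ sumTo n (λ i → f (n ∸ suc i))
sumTo-reverse zero    f = refl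
sumTo-reverse (suc n) f = trans (cong (_+ f n) (sumTo-reverse n f))
  (trans (ℤₚ.+-comm _ (f n)) (sym (sumTo-head n (λ i → f (suc n ∸ suc i)))))

sumTo-split : ∀ m n (f : ℕ → ℤ) → sumTo (m ℕ.+ n) f ≡ sumTo m f + sumTo n (λ i → f (m ℕ.+ i))
sumTo-split m zero    f = trans (cong (λ k → sumTo k f) (ℕₚ.+-identityʳ m)) (sym (ℤₚ.+-identityʳ _))
sumTo-split m (suc n) f = trans (cong (λ k → sumTo k f) (ℕₚ.+-suc m n))
  (trans (cong (_+ f (m ℕ.+ n)) (sumTo-split m n f)) (ℤₚ.+-assoc (sumTo m f) _ _))

sumTo-trim : ∀ {a b} (f : ℕ → ℤ) → a ≤ b → (∀ i → a ≤ i → f i ≡ 0ℤ) → sumTo b f ≡ sumTo a f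
sumTo-trim {a} {b} f a≤b tail≡0 = begin
  sumTo b f                                          ≡⟨ cong (λ k → sumTo k f) (ℕₚ.m+[n∸m]≡n a≤b) ⟨
  sumTo (a ℕ.+ (b ∸ a)) f                            ≡⟨ sumTo-split a (b ∸ a) f ⟩
  sumTo a f + sumTo (b ∸ a) (λ i → f (a ℕ.+ i))      ≡⟨ cong (sumTo a f +_) (sumTo-zero (b ∸ a) (λ i _ → tail≡0 (a ℕ.+ i) (ℕₚ.m≤m+n a i))) ⟩
  sumTo a f + 0ℤ                                     ≡⟨ ℤₚ.+-identityʳ _ ⟩
  sumTo a f                                          ∎
  where open ≡-Reasoning

sumTo-swap : ∀ a b (f : ℕ → ℕ → ℤ) → sumTo a (λ i → sumTo b (f i)) ≡ sumTo b (λ j → sumTo a (λ i → f i j))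
sumTo-swap zero    b f = sym (sumTo-zero b (λ _ _ → refl))
sumTo-swap (suc a) b f = trans (cong (_+ sumTo b (f a)) (sumTo-swap a b f)) (sym (sumTo-distrib-+ b _ _))

sumTo-triangle : ∀ n (F : ℕ → ℕ → ℤ) →
  sumTo (suc n) (λ i → sumTo (suc i) (λ a → F a i)) ≡
  sumTo (suc n) (λ a → sumTo (suc (n ∸ a)) (λ b → F a (a ℕ.+ b)))
sumTo-triangle zero    F = refl
sumTo-triangle (suc n) F = begin
  sumTo (suc n) (λ i → sumTo (suc i) (λ a → F a i)) + sumTo (suc (suc n)) (λ a → F a (suc n))
    ≡⟨ cong (_+ sumTo (suc (suc n)) (λ a → F a (suc n))) (sumTo-triangle n F) ⟩
  Rows n + (sumTo (suc n) (λ a → F a (suc n)) + F (suc n) (suc n))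
    ≡⟨ ℤₚ.+-assoc (Rows n) _ _ ⟨
  (Rows n + sumTo (suc n) (λ a → F a (suc n))) + F (suc n) (suc n)
    ≡⟨ cong₂ _+_ (sumTo-distrib-+ (suc n) _ _) diagonal ⟨
  sumTo (suc n) (λ a → Row n a + F a (suc n)) + sumTo 1 (λ b → F (suc n) (suc n ℕ.+ b))
    ≡⟨ cong₂ _+_ (sumTo-cong-< (suc n) extend-row) (cong (λ k → sumTo (suc k) (λ b → F (suc n) (suc n ℕ.+ b))) (ℕₚ.n∸n≡0 n)) ⟨
  Rows (suc n) ∎
  where
  open ≡-Reasoning
  Row : ℕ → ℕ → ℤ
  Row n a = sumTo (suc (n ∸ a)) (λ b → F a (a ℕ.+ b))
  Rows : ℕ → ℤ
  Rows n = sumTo (suc n) (Row n)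
  diagonal : sumTo 1 (λ b → F (suc n) (suc n ℕ.+ b)) ≡ F (suc n) (suc n)
  diagonal = trans (ℤₚ.+-identityˡ _) (cong (F (suc n)) (ℕₚ.+-identityʳ (suc n)))
  extend-row : ∀ a → a < suc n → Row (suc n) a ≡ Row n a + F a (suc n)
  extend-row a (s≤s a≤n) = begin
    Row (suc n) a                                   ≡⟨ cong (λ k → sumTo (suc k) (λ b → F a (a ℕ.+ b))) (ℕₚ.+-∸-assoc 1 a≤n) ⟩
    sumTo (suc (suc (n ∸ a))) (λ b → F a (a ℕ.+ b)) ≡⟨ cong (λ k → Row n a + F a k) a+[1+n∸a]≡1+n ⟩
    Row n a + F a (suc n)                           ∎
    where
    a+[1+n∸a]≡1+n : a ℕ.+ suc (n ∸ a) ≡ suc n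
    a+[1+n∸a]≡1+n = trans (ℕₚ.+-suc a (n ∸ a)) (cong suc (ℕₚ.m+[n∸m]≡n a≤n))

sumTo-pairs : ∀ n (f : ℕ → ℤ) → sumTo (2 ℕ.* n) f ≡ sumTo n (λ i → f (2 ℕ.* i) + f (2 ℕ.* i ℕ.+ 1))
sumTo-pairs zero    f = refl
sumTo-pairs (suc n) f = begin
  sumTo (2 ℕ.* suc n) f                                ≡⟨ cong (λ k → sumTo k f) (ℕₚ.*-suc 2 n) ⟩
  sumTo (2 ℕ.* n) f + f (2 ℕ.* n) + f (suc (2 ℕ.* n))  ≡⟨ cong₂ (λ s k → s + f (2 ℕ.* n) + f k) (sumTo-pairs n f) (ℕₚ.+-comm 1 (2 ℕ.* n)) ⟩
  sumTo n _ + f (2 ℕ.* n) + f (2 ℕ.* n ℕ.+ 1)          ≡⟨ ℤₚ.+-assoc (sumTo n _) _ _ ⟩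
  sumTo (suc n) (λ i → f (2 ℕ.* i) + f (2 ℕ.* i ℕ.+ 1)) ∎
  where open ≡-Reasoning

sumTo-if : ∀ n b (f : ℕ → ℤ) → sumTo n (λ i → if b then f i else 0ℤ) ≡ (if b then sumTo n f else 0ℤ)
sumTo-if n true  f = refl
sumTo-if n false f = sumTo-zero n (λ _ _ → refl)

-- Formal power series

⊛-cong : ∀ {f f′ g g′} → f ≗ f′ → g ≗ g′ → f ⊛ g ≗ f′ ⊛ g′
⊛-cong f≗f′ g≗g′ N = sumTo-cong (suc N) (λ i → cong₂ _*_ (f≗f′ i) (g≗g′ (N ∸ i)))

⊛-congˡ : ∀ {f f′} g → f ≗ f′ → f ⊛ g ≗ f′ ⊛ g
⊛-congˡ g f≗f′ = ⊛-cong {g = g} {g′ = g} f≗f′ (λ _ → refl)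

⊛-congʳ : ∀ f {g g′} → g ≗ g′ → f ⊛ g ≗ f ⊛ g′
⊛-congʳ f g≗g′ = ⊛-cong {f = f} {f′ = f} (λ _ → refl) g≗g′

⊛-congˡ-≤ : ∀ {f f′} g N → (∀ i → i ≤ N → f i ≡ f′ i) → (f ⊛ g) N ≡ (f′ ⊛ g) N
⊛-congˡ-≤ g N f≡f′ = sumTo-cong-< (suc N) (λ i i≤N → cong (_* g (N ∸ i)) (f≡f′ i (ℕₚ.≤-pred i≤N)))

⊛-comm : ∀ f g → f ⊛ g ≗ g ⊛ f
⊛-comm f g N = trans (sumTo-reverse (suc N) _) (sumTo-cong-< (suc N) (λ i i≤N →
  trans (cong (λ k → f (N ∸ i) * g k) (ℕₚ.m∸[m∸n]≡n (ℕₚ.≤-pred i≤N))) (ℤₚ.*-comm (f (N ∸ i)) (g i))))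

⊛-assoc : ∀ f g h → (f ⊛ g) ⊛ h ≗ f ⊛ (g ⊛ h)
⊛-assoc f g h N = begin
  sumTo (suc N) (λ i → sumTo (suc i) (λ a → f a * g (i ∸ a)) * h (N ∸ i))
    ≡⟨ sumTo-cong (suc N) (λ i → sumTo-*ʳ (suc i) (h (N ∸ i)) _) ⟩
  sumTo (suc N) (λ i → sumTo (suc i) (λ a → f a * g (i ∸ a) * h (N ∸ i)))
    ≡⟨ sumTo-triangle N (λ a i → f a * g (i ∸ a) * h (N ∸ i)) ⟩
  sumTo (suc N) (λ a → sumTo (suc (N ∸ a)) (λ b → f a * g (a ℕ.+ b ∸ a) * h (N ∸ (a ℕ.+ b))))
    ≡⟨ sumTo-cong (suc N) (λ a → sumTo-cong (suc (N ∸ a)) (λ b →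
         trans (cong₂ (λ x y → f a * g x * h y) (ℕₚ.m+n∸m≡n a b) (sym (ℕₚ.∸-+-assoc N a b)))
               (ℤₚ.*-assoc (f a) (g b) (h (N ∸ a ∸ b))))) ⟩
  sumTo (suc N) (λ a → sumTo (suc (N ∸ a)) (λ b → f a * (g b * h (N ∸ a ∸ b))))
    ≡⟨ sumTo-cong (suc N) (λ a → sumTo-*ˡ (suc (N ∸ a)) (f a) _) ⟨
  sumTo (suc N) (λ a → f a * sumTo (suc (N ∸ a)) (λ b → g b * h (N ∸ a ∸ b))) ∎
  where open ≡-Reasoning

⊛-distribˡ : ∀ f g h → f ⊛ (g ⊕ h) ≗ f ⊛ g ⊕ f ⊛ h
⊛-distribˡ f g h N =
  trans (sumTo-cong (suc N) (λ i → ℤₚ.*-distribˡ-+ (f i) (g (N ∸ i)) (h (N ∸ i)))) (sumTo-distrib-+ (suc N) _ _)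

⊛-distribʳ : ∀ f g h → (g ⊕ h) ⊛ f ≗ g ⊛ f ⊕ h ⊛ f
⊛-distribʳ f g h N = begin
  ((g ⊕ h) ⊛ f) N        ≡⟨ ⊛-comm (g ⊕ h) f N ⟩
  (f ⊛ (g ⊕ h)) N        ≡⟨ ⊛-distribˡ f g h N ⟩
  (f ⊛ g) N + (f ⊛ h) N  ≡⟨ cong₂ _+_ (⊛-comm f g N) (⊛-comm f h N) ⟩
  (g ⊛ f ⊕ h ⊛ f) N      ∎
  where open ≡-Reasoning

⊛-zeroʳ : ∀ f → f ⊛ zeroS ≗ zeroS
⊛-zeroʳ f N = sumTo-zero (suc N) (λ i _ → ℤₚ.*-zeroʳ (f i))

⊛-at-0 : ∀ f g → (f ⊛ g) 0 ≡ f 0 * g 0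
⊛-at-0 f g = ℤₚ.+-identityˡ _

mono-refl : ∀ a → mono a a ≡ 1ℤ
mono-refl a with a ≡ᵇ a | ℕₚ.≡⇒≡ᵇ a a refl
... | true | _ = refl

mono-≢ : ∀ {a i} → i ≢ a → mono a i ≡ 0ℤ
mono-≢ {a} {i} i≢a with i ≡ᵇ a | ℕₚ.≡ᵇ⇒≡ i a
... | true  | i≡a = ⊥-elim (i≢a (i≡a _))
... | false | _   = refl

mono-cong : ∀ {a i b j} → (i ≡ a → j ≡ b) → (j ≡ b → i ≡ a) → mono a i ≡ mono b j
mono-cong {a} {i} {b} {j} to from with i ℕ.≟ a | j ℕ.≟ b
... | yes refl | yes refl = trans (mono-refl a) (sym (mono-refl b))
... | yes i≡a  | no  j≢b  = ⊥-elim (j≢b (to i≡a))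
... | no  i≢a  | yes j≡b  = ⊥-elim (i≢a (from j≡b))
... | no  i≢a  | no  j≢b  = trans (mono-≢ i≢a) (sym (mono-≢ j≢b))

mono-sym : ∀ a i → mono a i ≡ mono i a
mono-sym a i = mono-cong {a} {i} {i} {a} sym sym

sumTo-mono-≥ : ∀ n a (g : ℕ → ℤ) → n ≤ a → sumTo n (λ i → mono a i * g i) ≡ 0ℤ
sumTo-mono-≥ n a g n≤a = sumTo-zero n (λ i i<n →
  trans (cong (_* g i) (mono-≢ (ℕₚ.<⇒≢ (ℕₚ.<-≤-trans i<n n≤a)))) (ℤₚ.*-zeroˡ (g i)))

sumTo-mono : ∀ n a (g : ℕ → ℤ) → a < n → sumTo n (λ i → mono a i * g i) ≡ g a
sumTo-mono (suc n) a g a<1+n with ℕₚ.m≤n⇒m<n∨m≡n (ℕₚ.≤-pred a<1+n)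
... | inj₁ a<n  = begin
  sumTo n (λ i → mono a i * g i) + mono a n * g n ≡⟨ cong₂ _+_ (sumTo-mono n a g a<n) (cong (_* g n) (mono-≢ (ℕₚ.>⇒≢ a<n))) ⟩
  g a + 0ℤ * g n                                  ≡⟨ ℤₚ.+-identityʳ (g a) ⟩
  g a                                             ∎
  where open ≡-Reasoning
... | inj₂ refl = begin
  sumTo a (λ i → mono a i * g i) + mono a a * g a ≡⟨ cong₂ _+_ (sumTo-mono-≥ a a g ℕₚ.≤-refl) (cong (_* g a) (mono-refl a)) ⟩
  0ℤ + 1ℤ * g a                                   ≡⟨ trans (ℤₚ.+-identityˡ _) (ℤₚ.*-identityˡ (g a)) ⟩
  g a                                             ∎
  where open ≡-Reasoning

mono-⊛-≤ : ∀ {a N} g → a ≤ N → (mono a ⊛ g) N ≡ g (N ∸ a)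
mono-⊛-≤ {a} {N} g a≤N = sumTo-mono (suc N) a (λ i → g (N ∸ i)) (s≤s a≤N)

mono-⊛-> : ∀ {a N} g → N < a → (mono a ⊛ g) N ≡ 0ℤ
mono-⊛-> {a} {N} g N<a = sumTo-mono-≥ (suc N) a (λ i → g (N ∸ i)) N<a

mono-+ : ∀ a b → mono a ⊛ mono b ≗ mono (a ℕ.+ b)
mono-+ a b N with a ℕ.≤? N
... | yes a≤N = trans (mono-⊛-≤ (mono b) a≤N)
  (mono-cong (λ N∸a≡b → trans (sym (ℕₚ.m+[n∸m]≡n a≤N)) (cong (a ℕ.+_) N∸a≡b))
             (λ N≡a+b → trans (cong (_∸ a) N≡a+b) (ℕₚ.m+n∸m≡n a b)))
... | no  a≰N = trans (mono-⊛-> (mono b) (ℕₚ.≰⇒> a≰N))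
  (sym (mono-≢ (λ N≡a+b → a≰N (subst (a ≤_) (sym N≡a+b) (ℕₚ.m≤m+n a b)))))

⊛-identityˡ : ∀ g → oneS ⊛ g ≗ g
⊛-identityˡ g N = mono-⊛-≤ g z≤n

⊛-identityʳ : ∀ g → g ⊛ oneS ≗ g
⊛-identityʳ g N = trans (⊛-comm g oneS N) (⊛-identityˡ g N)

negS : FPS → FPS
negS f N = - f N

FPS-setoid : Setoid _ _
FPS-setoid = record
  { Carrier       = FPS
  ; _≈_           = _≗_
  ; isEquivalence = record
    { refl  = λ _ → refl
    ; sym   = λ f≗g N → sym (f≗g N)
    ; trans = λ f≗g g≗h N → trans (f≗g N) (g≗h N)
    }
  }

open Setoid FPS-setoid public using () renaming (refl to ≗-refl; sym to ≗-sym; trans to ≗-trans)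

FPS-commutativeRing : CommutativeRing _ _
FPS-commutativeRing = record
  { Carrier           = FPS
  ; _≈_               = _≗_
  ; _+_               = _⊕_
  ; _*_               = _⊛_
  ; -_                = negS
  ; 0#                = zeroS
  ; 1#                = oneS
  ; isCommutativeRing = record
    { isRing = record
      { +-isAbelianGroup = record
        { isGroup = record
          { isMonoid = record
            { isSemigroup = record
              { isMagma = record
                { isEquivalence = Setoid.isEquivalence FPS-setoid
                ; ∙-cong        = λ f≗f′ g≗g′ N → cong₂ _+_ (f≗f′ N) (g≗g′ N)
                }
              ; assoc = λ f g h N → ℤₚ.+-assoc (f N) (g N) (h N)
              }
            ; identity = (λ f N → ℤₚ.+-identityˡ (f N)) , (λ f N → ℤₚ.+-identityʳ (f N))
            }
          ; inverse = (λ f N → ℤₚ.+-inverseˡ (f N)) , (λ f N → ℤₚ.+-inverseʳ (f N))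
          ; ⁻¹-cong = λ f≗g N → cong -_ (f≗g N)
          }
        ; comm = λ f g N → ℤₚ.+-comm (f N) (g N)
        }
      ; *-cong     = ⊛-cong
      ; *-assoc    = ⊛-assoc
      ; *-identity = ⊛-identityˡ , ⊛-identityʳ
      ; distrib    = ⊛-distribˡ , ⊛-distribʳ
      }
    ; *-comm = ⊛-comm
    }
  }

scale : ℤ → FPS → FPS
scale c f N = c * f N

scale-⊛ : ∀ c f g → scale c f ⊛ g ≗ scale c (f ⊛ g)
scale-⊛ c f g N =
  trans (sumTo-cong (suc N) (λ i → ℤₚ.*-assoc c (f i) (g (N ∸ i)))) (sym (sumTo-*ˡ (suc N) c _))

scale-⊛-scale : ∀ c d f g → scale c f ⊛ scale d g ≗ scale (c * d) (f ⊛ g)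
scale-⊛-scale c d f g N = begin
  (scale c f ⊛ scale d g) N  ≡⟨ scale-⊛ c f (scale d g) N ⟩
  c * (f ⊛ scale d g) N      ≡⟨ cong (c *_) (⊛-comm f (scale d g) N) ⟩
  c * (scale d g ⊛ f) N      ≡⟨ cong (c *_) (scale-⊛ d g f N) ⟩
  c * (d * (g ⊛ f) N)        ≡⟨ cong (λ x → c * (d * x)) (⊛-comm g f N) ⟩
  c * (d * (f ⊛ g) N)        ≡⟨ ℤₚ.*-assoc c d _ ⟨
  c * d * (f ⊛ g) N          ∎
  where open ≡-Reasoning

-- Defined by cases rather than as scale c oneS so that constant 1ℤ is definitionally oneS, which the ring
-- solver relies on when its constant con 1ℤ meets oneS in a goal.
constant : ℤ → FPS
constant c N = if N ≡ᵇ 0 then c else 0ℤ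

constant-scale : ∀ c → constant c ≗ scale c oneS
constant-scale c zero    = sym (ℤₚ.*-identityʳ c)
constant-scale c (suc N) = sym (ℤₚ.*-zeroʳ c)

constant-homomorphism : CommutativeRing.rawRing ℤₚ.+-*-commutativeRing ACR.-Raw-AlmostCommutative⟶ ACR.fromCommutativeRing FPS-commutativeRing
constant-homomorphism = record
  { ⟦_⟧    = constant
  ; +-homo = λ a b N → begin
      constant (a + b) N              ≡⟨ constant-scale (a + b) N ⟩
      (a + b) * oneS N                ≡⟨ ℤₚ.*-distribʳ-+ (oneS N) a b ⟩
      a * oneS N + b * oneS N         ≡⟨ cong₂ _+_ (constant-scale a N) (constant-scale b N) ⟨
      constant a N + constant b N     ∎
  ; *-homo = λ a b N → begin
      constant (a * b) N              ≡⟨ constant-scale (a * b) N ⟩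
      a * b * oneS N                  ≡⟨ cong (a * b *_) (⊛-identityʳ oneS N) ⟨
      a * b * (oneS ⊛ oneS) N         ≡⟨ scale-⊛-scale a b oneS oneS N ⟨
      (scale a oneS ⊛ scale b oneS) N ≡⟨ ⊛-cong (constant-scale a) (constant-scale b) N ⟨
      (constant a ⊛ constant b) N     ∎
  ; -‿homo = λ a N → begin
      constant (- a) N                ≡⟨ constant-scale (- a) N ⟩
      - a * oneS N                    ≡⟨ ℤₚ.neg-distribˡ-* a (oneS N) ⟨
      - (a * oneS N)                  ≡⟨ cong -_ (constant-scale a N) ⟨
      - constant a N                  ∎
  ; 0-homo = λ N → trans (constant-scale 0ℤ N) (ℤₚ.*-zeroˡ (oneS N))
  ; 1-homo = λ N → refl
  }
  where open ≡-Reasoning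

constant-≟ : ∀ a b → Maybe (constant a ≗ constant b)
constant-≟ a b with a ℤ.≟ b
... | yes refl = just (λ _ → refl)
... | no  _    = nothing

module FPS-Solver = Algebra.Solver.Ring _ (ACR.fromCommutativeRing FPS-commutativeRing) constant-homomorphism constant-≟

module ≗-Reasoning = SetoidReasoning FPS-setoid

nth-invRev : ∀ a N i → i ≤ N → nth (invRev a N) i ≡ inv a (N ∸ i)
nth-invRev a N       zero    _         = refl
nth-invRev a (suc N) (suc i) (s≤s i≤N) = nth-invRev a N i i≤N

inv-suc : ∀ a N → inv a (suc N) ≡ - sumTo (suc N) (λ i → a (suc i) * inv a (N ∸ i))
inv-suc a N = cong -_ (sumTo-cong-< (suc N) (λ i i≤N → cong (a (suc i) *_) (nth-invRev a N i (ℕₚ.≤-pred i≤N))))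

⊛-inverseʳ : ∀ a → a 0 ≡ 1ℤ → a ⊛ inv a ≗ oneS
⊛-inverseʳ a a₀≡1 zero    = cong (λ x → 0ℤ + x * 1ℤ) a₀≡1
⊛-inverseʳ a a₀≡1 (suc N) = begin
  sumTo (suc (suc N)) (λ i → a i * inv a (suc N ∸ i)) ≡⟨ sumTo-head (suc N) _ ⟩
  a 0 * inv a (suc N) + S                            ≡⟨ cong₂ (λ x y → x * y + S) a₀≡1 (inv-suc a N) ⟩
  1ℤ * - S + S                                       ≡⟨ cong (_+ S) (ℤₚ.*-identityˡ (- S)) ⟩
  - S + S                                            ≡⟨ ℤₚ.+-inverseˡ S ⟩
  0ℤ                                                 ∎
  where
  open ≡-Reasoning
  S = sumTo (suc N) (λ i → a (suc i) * inv a (N ∸ i))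

⊛-inverseˡ : ∀ a → a 0 ≡ 1ℤ → inv a ⊛ a ≗ oneS
⊛-inverseˡ a a₀≡1 N = trans (⊛-comm (inv a) a N) (⊛-inverseʳ a a₀≡1 N)

x⊛a≗y⇒x≗y⊛a⁻¹ : ∀ a x y → a 0 ≡ 1ℤ → x ⊛ a ≗ y → x ≗ y ⊛ inv a
x⊛a≗y⇒x≗y⊛a⁻¹ a x y a₀≡1 x⊛a≗y = begin
  x                ≈⟨ ⊛-identityʳ x ⟨
  x ⊛ oneS         ≈⟨ ⊛-congʳ x (⊛-inverseʳ a a₀≡1) ⟨
  x ⊛ (a ⊛ inv a)  ≈⟨ ⊛-assoc x a (inv a) ⟨
  (x ⊛ a) ⊛ inv a  ≈⟨ ⊛-congˡ (inv a) x⊛a≗y ⟩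
  y ⊛ inv a        ∎
  where open ≗-Reasoning

⊛-replace-factor : ∀ {P U V W} M → W 0 ≡ 1ℤ → P ≗ U ⊛ (W ⊛ V) → U ⊛ (M ⊛ V) ≗ (P ⊛ inv W) ⊛ M
⊛-replace-factor {P} {U} {V} {W} M W₀≡1 P≗UWV = begin
  U ⊛ (M ⊛ V)        ≈⟨ x⊛a≗y⇒x≗y⊛a⁻¹ W (U ⊛ (M ⊛ V)) (P ⊛ M) W₀≡1 UMV⊛W≗P⊛M ⟩
  (P ⊛ M) ⊛ inv W    ≈⟨ solve 3 (λ P M I → (P :* M) :* I := (P :* I) :* M) ≗-refl P M (inv W) ⟩
  (P ⊛ inv W) ⊛ M    ∎
  where
  open ≗-Reasoning
  open FPS-Solver
  UMV⊛W≗P⊛M : (U ⊛ (M ⊛ V)) ⊛ W ≗ P ⊛ M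
  UMV⊛W≗P⊛M = begin
    (U ⊛ (M ⊛ V)) ⊛ W  ≈⟨ solve 4 (λ U M V W → (U :* (M :* V)) :* W := (U :* (W :* V)) :* M) ≗-refl U M V W ⟩
    (U ⊛ (W ⊛ V)) ⊛ M  ≈⟨ ⊛-congˡ M P≗UWV ⟨
    P ⊛ M              ∎

-- Generating functions of sublists

private variable A : Set

sumOver : List A → (A → ℤ) → ℤ
sumOver []       f = 0ℤ
sumOver (x ∷ xs) f = f x + sumOver xs f

sumSeries : List A → (A → FPS) → FPS
sumSeries xs F N = sumOver xs (λ x → F x N)

sublists : List A → List (List A)
sublists []       = [] ∷ []
sublists (x ∷ xs) = map (x ∷_) (sublists xs) ++ sublists xs

sumOver-map : ∀ {B : Set} (h : B → A) xs f → sumOver (map h xs) f ≡ sumOver xs (λ x → f (h x))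
sumOver-map h []       f = refl
sumOver-map h (x ∷ xs) f = cong (f (h x) +_) (sumOver-map h xs f)

sumOver-++ : ∀ (xs ys : List A) f → sumOver (xs ++ ys) f ≡ sumOver xs f + sumOver ys f
sumOver-++ []       ys f = sym (ℤₚ.+-identityˡ _)
sumOver-++ (x ∷ xs) ys f = trans (cong (f x +_) (sumOver-++ xs ys f)) (sym (ℤₚ.+-assoc (f x) _ _))

sumOver-cong∈ : ∀ (xs : List A) {f g} → (∀ x → x ∈ xs → f x ≡ g x) → sumOver xs f ≡ sumOver xs g
sumOver-cong∈ []       f≡g = refl
sumOver-cong∈ (x ∷ xs) f≡g = cong₂ _+_ (f≡g x (here refl)) (sumOver-cong∈ xs (λ y y∈xs → f≡g y (there y∈xs)))

sumOver-cong : ∀ (xs : List A) {f g} → f ≗ g → sumOver xs f ≡ sumOver xs g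
sumOver-cong xs f≗g = sumOver-cong∈ xs (λ x _ → f≗g x)

sumOver-zero : ∀ (xs : List A) {f} → (∀ x → x ∈ xs → f x ≡ 0ℤ) → sumOver xs f ≡ 0ℤ
sumOver-zero []       f≡0 = refl
sumOver-zero (x ∷ xs) f≡0 = cong₂ _+_ (f≡0 x (here refl)) (sumOver-zero xs (λ y y∈xs → f≡0 y (there y∈xs)))

sumOver-distrib-+ : ∀ (xs : List A) f g → sumOver xs (λ x → f x + g x) ≡ sumOver xs f + sumOver xs g
sumOver-distrib-+ []       f g = refl
sumOver-distrib-+ (x ∷ xs) f g =
  trans (cong (f x + g x +_) (sumOver-distrib-+ xs f g)) (interchange (f x) (g x) _ _)

sumOver-*ʳ : ∀ (xs : List A) c f → sumOver xs f * c ≡ sumOver xs (λ x → f x * c)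
sumOver-*ʳ []       c f = ℤₚ.*-zeroˡ c
sumOver-*ʳ (x ∷ xs) c f = trans (ℤₚ.*-distribʳ-+ c (f x) _) (cong (f x * c +_) (sumOver-*ʳ xs c f))

sumTo-sumOver : ∀ n (xs : List A) (f : ℕ → A → ℤ) →
  sumTo n (λ i → sumOver xs (f i)) ≡ sumOver xs (λ x → sumTo n (λ i → f i x))
sumTo-sumOver zero    xs f = sym (sumOver-zero xs (λ _ _ → refl))
sumTo-sumOver (suc n) xs f =
  trans (cong (_+ sumOver xs (f n)) (sumTo-sumOver n xs f)) (sym (sumOver-distrib-+ xs _ _))

sumSeries-⊛ : ∀ (xs : List A) F g → sumSeries xs F ⊛ g ≗ sumSeries xs (λ x → F x ⊛ g)
sumSeries-⊛ xs F g N = trans (sumTo-cong (suc N) (λ i → sumOver-*ʳ xs (g (N ∸ i)) (λ x → F x i)))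
                             (sumTo-sumOver (suc N) xs (λ i x → F x i * g (N ∸ i)))

⊛-sumSeries : ∀ (xs : List A) F g → g ⊛ sumSeries xs F ≗ sumSeries xs (λ x → g ⊛ F x)
⊛-sumSeries xs F g N = begin
  (g ⊛ sumSeries xs F) N          ≡⟨ ⊛-comm g (sumSeries xs F) N ⟩
  (sumSeries xs F ⊛ g) N          ≡⟨ sumSeries-⊛ xs F g N ⟩
  sumOver xs (λ x → (F x ⊛ g) N)  ≡⟨ sumOver-cong xs (λ x → ⊛-comm (F x) g N) ⟩
  sumOver xs (λ x → (g ⊛ F x) N)  ∎
  where open ≡-Reasoning

sumOver-sublists-++ : ∀ (xs ys : List A) g →
  sumOver (sublists (xs ++ ys)) g ≡ sumOver (sublists xs) (λ μ → sumOver (sublists ys) (λ ν → g (μ ++ ν)))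
sumOver-sublists-++ []       ys g = sym (ℤₚ.+-identityʳ _)
sumOver-sublists-++ {A = A} (x ∷ xs) ys g = begin
  sumOver (map (x ∷_) (sublists (xs ++ ys)) ++ sublists (xs ++ ys)) g
    ≡⟨ sumOver-++ (map (x ∷_) (sublists (xs ++ ys))) _ g ⟩
  sumOver (map (x ∷_) (sublists (xs ++ ys))) g + sumOver (sublists (xs ++ ys)) g
    ≡⟨ cong₂ _+_ (trans (sumOver-map (x ∷_) (sublists (xs ++ ys)) g) (sumOver-sublists-++ xs ys (λ l → g (x ∷ l))))
                 (sumOver-sublists-++ xs ys g) ⟩
  sumOver (sublists xs) (λ μ → Inner (x ∷ μ)) + sumOver (sublists xs) Inner
    ≡⟨ cong (_+ sumOver (sublists xs) Inner) (sumOver-map (x ∷_) (sublists xs) Inner) ⟨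
  sumOver (map (x ∷_) (sublists xs)) Inner + sumOver (sublists xs) Inner
    ≡⟨ sumOver-++ (map (x ∷_) (sublists xs)) _ Inner ⟨
  sumOver (map (x ∷_) (sublists xs) ++ sublists xs) Inner ∎
  where
  open ≡-Reasoning
  Inner : List A → ℤ
  Inner μ = sumOver (sublists ys) (λ ν → g (μ ++ ν))

sublists-All : ∀ {P : A → Set} xs {μ} → All P xs → μ ∈ sublists xs → All P μ
sublists-All []       []         (here refl) = []
sublists-All (x ∷ xs) (px ∷ pxs) μ∈ with ∈ₚ.∈-++⁻ (map (x ∷_) (sublists xs)) μ∈
... | inj₂ μ∈xs = sublists-All xs pxs μ∈xs
... | inj₁ μ∈x∷xs with ∈ₚ.∈-map⁻ (x ∷_) μ∈x∷xs
...   | ν , ν∈xs , refl = px ∷ sublists-All xs pxs ν∈xs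

weightedGF : List ℕ → (List ℕ → ℤ) → FPS
weightedGF S w N = sumOver (sublists S) (λ μ → w μ * mono (sum μ) N)

subsetGF : List ℕ → FPS
subsetGF S = weightedGF S (λ _ → 1ℤ)

weightedGF-cong∈ : ∀ S {w w′} → (∀ μ → μ ∈ sublists S → w μ ≡ w′ μ) → weightedGF S w ≗ weightedGF S w′
weightedGF-cong∈ S w≡w′ N = sumOver-cong∈ (sublists S) (λ μ μ∈ → cong (_* mono (sum μ) N) (w≡w′ μ μ∈))

weightedGF-zero : ∀ S {w} → (∀ μ → μ ∈ sublists S → w μ ≡ 0ℤ) → weightedGF S w ≗ zeroS
weightedGF-zero S w≡0 N = sumOver-zero (sublists S) (λ μ μ∈ → cong (_* mono (sum μ) N) (w≡0 μ μ∈))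

weightedGF-[] : ∀ w → weightedGF [] w ≗ constant (w [])
weightedGF-[] w N = trans (ℤₚ.+-identityʳ _) (sym (constant-scale (w []) N))

weightedGF-∷ : ∀ x S w → weightedGF (x ∷ S) w ≗ mono x ⊛ weightedGF S (λ μ → w (x ∷ μ)) ⊕ weightedGF S w
weightedGF-∷ x S w N = begin
  sumOver (map (x ∷_) (sublists S) ++ sublists S) term
    ≡⟨ sumOver-++ (map (x ∷_) (sublists S)) (sublists S) term ⟩
  sumOver (map (x ∷_) (sublists S)) term + weightedGF S w N
    ≡⟨ cong (_+ weightedGF S w N) (trans (sumOver-map (x ∷_) (sublists S) term) (sumOver-cong (sublists S) shift)) ⟩
  sumOver (sublists S) (λ μ → (mono x ⊛ scale (w (x ∷ μ)) (mono (sum μ))) N) + weightedGF S w N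
    ≡⟨ cong (_+ weightedGF S w N) (⊛-sumSeries (sublists S) (λ μ → scale (w (x ∷ μ)) (mono (sum μ))) (mono x) N) ⟨
  (mono x ⊛ weightedGF S (λ μ → w (x ∷ μ))) N + weightedGF S w N ∎
  where
  open ≡-Reasoning
  term : List ℕ → ℤ
  term μ = w μ * mono (sum μ) N
  shift : ∀ μ → term (x ∷ μ) ≡ (mono x ⊛ scale (w (x ∷ μ)) (mono (sum μ))) N
  shift μ = begin
    w (x ∷ μ) * mono (x ℕ.+ sum μ) N                 ≡⟨ cong (w (x ∷ μ) *_) (mono-+ x (sum μ) N) ⟨
    w (x ∷ μ) * (mono x ⊛ mono (sum μ)) N            ≡⟨ cong (w (x ∷ μ) *_) (⊛-comm (mono x) (mono (sum μ)) N) ⟩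
    scale (w (x ∷ μ)) (mono (sum μ) ⊛ mono x) N      ≡⟨ scale-⊛ (w (x ∷ μ)) (mono (sum μ)) (mono x) N ⟨
    (scale (w (x ∷ μ)) (mono (sum μ)) ⊛ mono x) N    ≡⟨ ⊛-comm (scale (w (x ∷ μ)) (mono (sum μ))) (mono x) N ⟩
    (mono x ⊛ scale (w (x ∷ μ)) (mono (sum μ))) N    ∎

weightedGF-++ : ∀ S₁ S₂ w w₁ w₂ → (∀ {μ ν} → μ ∈ sublists S₁ → ν ∈ sublists S₂ → w (μ ++ ν) ≡ w₁ μ * w₂ ν) →
  weightedGF (S₁ ++ S₂) w ≗ weightedGF S₁ w₁ ⊛ weightedGF S₂ w₂
weightedGF-++ S₁ S₂ w w₁ w₂ w-mult N = begin
  sumOver (sublists (S₁ ++ S₂)) (λ λ′ → w λ′ * mono (sum λ′) N)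
    ≡⟨ sumOver-sublists-++ S₁ S₂ _ ⟩
  sumOver (sublists S₁) (λ μ → sumOver (sublists S₂) (λ ν → w (μ ++ ν) * mono (sum (μ ++ ν)) N))
    ≡⟨ sumOver-cong∈ (sublists S₁) (λ μ μ∈ → sumOver-cong∈ (sublists S₂) (λ ν ν∈ → split μ∈ ν∈)) ⟩
  sumOver (sublists S₁) (λ μ → sumOver (sublists S₂) (λ ν → (term₁ μ ⊛ term₂ ν) N))
    ≡⟨ sumOver-cong (sublists S₁) (λ μ → ⊛-sumSeries (sublists S₂) term₂ (term₁ μ) N) ⟨
  sumOver (sublists S₁) (λ μ → (term₁ μ ⊛ weightedGF S₂ w₂) N)
    ≡⟨ sumSeries-⊛ (sublists S₁) term₁ (weightedGF S₂ w₂) N ⟨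
  (weightedGF S₁ w₁ ⊛ weightedGF S₂ w₂) N ∎
  where
  open ≡-Reasoning
  term₁ term₂ : List ℕ → FPS
  term₁ μ = scale (w₁ μ) (mono (sum μ))
  term₂ ν = scale (w₂ ν) (mono (sum ν))
  split : ∀ {μ ν} → μ ∈ sublists S₁ → ν ∈ sublists S₂ → w (μ ++ ν) * mono (sum (μ ++ ν)) N ≡ (term₁ μ ⊛ term₂ ν) N
  split {μ} {ν} μ∈ ν∈ = begin
    w (μ ++ ν) * mono (sum (μ ++ ν)) N        ≡⟨ cong₂ _*_ (w-mult μ∈ ν∈) (cong (λ k → mono k N) (sumₚ.sum-++ μ ν)) ⟩
    w₁ μ * w₂ ν * mono (sum μ ℕ.+ sum ν) N    ≡⟨ cong (w₁ μ * w₂ ν *_) (mono-+ (sum μ) (sum ν) N) ⟨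
    w₁ μ * w₂ ν * (mono (sum μ) ⊛ mono (sum ν)) N  ≡⟨ scale-⊛-scale (w₁ μ) (w₂ ν) (mono (sum μ)) (mono (sum ν)) N ⟨
    (term₁ μ ⊛ term₂ ν) N                      ∎

progression : ℕ → ℕ → List ℕ
progression lo zero    = []
progression lo (suc n) = lo ℕ.+ 2 ℕ.* n ∷ progression lo n

progression-++ : ∀ lo m n → progression lo (m ℕ.+ n) ≡ progression (lo ℕ.+ 2 ℕ.* m) n ++ progression lo m
progression-++ lo m zero    = cong (progression lo) (ℕₚ.+-identityʳ m)
progression-++ lo m (suc n) = trans (cong (progression lo) (ℕₚ.+-suc m n))
  (cong₂ _∷_ (shift lo m n) (progression-++ lo m n))
  where
  shift : ∀ lo m n → lo ℕ.+ 2 ℕ.* (m ℕ.+ n) ≡ lo ℕ.+ 2 ℕ.* m ℕ.+ 2 ℕ.* n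
  shift = solve-∀

progression-≥ : ∀ lo n → All (lo ≤_) (progression lo n)
progression-≥ lo zero    = []
progression-≥ lo (suc n) = ℕₚ.m≤m+n lo (2 ℕ.* n) ∷ progression-≥ lo n

progression-< : ∀ lo n → All (λ x → x ℕ.+ 2 ≤ lo ℕ.+ 2 ℕ.* n) (progression lo n)
progression-< lo zero    = []
progression-< lo (suc n) =
  ℕₚ.≤-reflexive (step lo n)
  ∷ All.map (λ x+2≤ → ℕₚ.≤-trans x+2≤ (ℕₚ.+-monoʳ-≤ lo (ℕₚ.*-monoʳ-≤ 2 (ℕₚ.n≤1+n n)))) (progression-< lo n)
  where
  step : ∀ lo n → lo ℕ.+ 2 ℕ.* n ℕ.+ 2 ≡ lo ℕ.+ 2 ℕ.* suc n
  step = solve-∀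

progression-top : ∀ lo n → All (_< lo ℕ.+ 2 ℕ.* n) (progression lo n)
progression-top lo n = All.map (λ {x} x+2≤ → ℕₚ.<-≤-trans (ℕₚ.m<m+n x (s≤s z≤n)) x+2≤) (progression-< lo n)

subsetGF-++ : ∀ S₁ S₂ → subsetGF (S₁ ++ S₂) ≗ subsetGF S₁ ⊛ subsetGF S₂
subsetGF-++ S₁ S₂ = weightedGF-++ S₁ S₂ (λ _ → 1ℤ) (λ _ → 1ℤ) (λ _ → 1ℤ) (λ _ _ → refl)

sum-progression : ∀ lo ℓ → sum (progression lo ℓ) ℕ.+ ℓ ≡ ℓ ℕ.* lo ℕ.+ ℓ ℕ.* ℓ
sum-progression lo zero    = refl
sum-progression lo (suc ℓ) = begin
  lo ℕ.+ 2 ℕ.* ℓ ℕ.+ S ℕ.+ suc ℓ          ≡⟨ regroup lo ℓ S ⟩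
  lo ℕ.+ 1 ℕ.+ 2 ℕ.* ℓ ℕ.+ (S ℕ.+ ℓ)      ≡⟨ cong (lo ℕ.+ 1 ℕ.+ 2 ℕ.* ℓ ℕ.+_) (sum-progression lo ℓ) ⟩
  lo ℕ.+ 1 ℕ.+ 2 ℕ.* ℓ ℕ.+ (ℓ ℕ.* lo ℕ.+ ℓ ℕ.* ℓ)  ≡⟨ expand lo ℓ ⟩
  suc ℓ ℕ.* lo ℕ.+ suc ℓ ℕ.* suc ℓ        ∎
  where
  open ≡-Reasoning
  S = sum (progression lo ℓ)
  regroup : ∀ lo ℓ S → lo ℕ.+ 2 ℕ.* ℓ ℕ.+ S ℕ.+ suc ℓ ≡ lo ℕ.+ 1 ℕ.+ 2 ℕ.* ℓ ℕ.+ (S ℕ.+ ℓ)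
  regroup = solve-∀
  expand : ∀ lo ℓ → lo ℕ.+ 1 ℕ.+ 2 ℕ.* ℓ ℕ.+ (ℓ ℕ.* lo ℕ.+ ℓ ℕ.* ℓ) ≡ suc ℓ ℕ.* lo ℕ.+ suc ℓ ℕ.* suc ℓ
  expand = solve-∀

poch-subsetGF : ∀ lo n → poch (negMono lo) 2 n ≗ subsetGF (progression lo n)
poch-subsetGF lo zero    N = sym (weightedGF-[] (λ _ → 1ℤ) N)
poch-subsetGF lo (suc n) = begin
  P ⊛ (oneS ⊖ negMono lo ⊛ mono (2 ℕ.* n))
    ≈⟨ solve 3 (λ P m₁ m₂ → P :* (con 1ℤ :- (:- m₁) :* m₂) := (m₁ :* m₂) :* P :+ P) ≗-refl P (mono lo) (mono (2 ℕ.* n)) ⟩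
  (mono lo ⊛ mono (2 ℕ.* n)) ⊛ P ⊕ P
    ≈⟨ (λ N → cong₂ _+_ (⊛-cong (mono-+ lo (2 ℕ.* n)) (poch-subsetGF lo n) N) (poch-subsetGF lo n N)) ⟩
  mono (lo ℕ.+ 2 ℕ.* n) ⊛ subsetGF (progression lo n) ⊕ subsetGF (progression lo n)
    ≈⟨ weightedGF-∷ (lo ℕ.+ 2 ℕ.* n) (progression lo n) (λ _ → 1ℤ) ⟨
  subsetGF (progression lo (suc n)) ∎
  where
  open ≗-Reasoning
  open FPS-Solver
  P = poch (negMono lo) 2 n

poch-at-0 : ∀ x d n → x 0 ≡ 0ℤ → poch x d n 0 ≡ 1ℤ
poch-at-0 x d zero    x₀≡0 = refl
poch-at-0 x d (suc n) x₀≡0 = begin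
  (poch x d n ⊛ (oneS ⊖ x ⊛ mono (d ℕ.* n))) 0  ≡⟨ ⊛-at-0 (poch x d n) (oneS ⊖ x ⊛ mono (d ℕ.* n)) ⟩
  poch x d n 0 * (1ℤ - (x ⊛ mono (d ℕ.* n)) 0)  ≡⟨ cong₂ (λ a b → a * (1ℤ - b)) (poch-at-0 x d n x₀≡0) x⊛q^dn-at-0 ⟩
  1ℤ                                            ∎
  where
  open ≡-Reasoning
  x⊛q^dn-at-0 : (x ⊛ mono (d ℕ.* n)) 0 ≡ 0ℤ
  x⊛q^dn-at-0 = trans (⊛-at-0 x (mono (d ℕ.* n))) (cong (_* mono (d ℕ.* n) 0) x₀≡0)

-- Gaussian binomial coefficients in base q²

q²! : ℕ → FPS
q²! n = poch (mono 2) 2 n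

q²!-at-0 : ∀ n → q²! n 0 ≡ 1ℤ
q²!-at-0 n = poch-at-0 (mono 2) 2 n refl

q²!-suc : ∀ n → q²! (suc n) ≗ q²! n ⊛ (oneS ⊖ mono (2 ℕ.+ 2 ℕ.* n))
q²!-suc n = ⊛-congʳ (q²! n) (λ N → cong (λ v → oneS N - v) (mono-+ 2 (2 ℕ.* n) N))

qbin2-≤ : ∀ {n k} → k ≤ n → qbin2 n k ≗ q²! n ⊛ inv (q²! k ⊛ q²! (n ∸ k))
qbin2-≤ {n} {k} k≤n with k ≤ᵇ n | ℕₚ.≤⇒≤ᵇ k≤n
... | true | _ = ≗-refl

qbin2-> : ∀ {n k} → n < k → qbin2 n k ≗ zeroS
qbin2-> {n} {k} n<k with k ≤ᵇ n | ℕₚ.≤ᵇ⇒≤ k n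
... | false | _   = ≗-refl
... | true  | k≤n = ⊥-elim (ℕₚ.<⇒≱ n<k (k≤n _))

qbin2-⊛ : ∀ {n k} → k ≤ n → qbin2 n k ⊛ (q²! k ⊛ q²! (n ∸ k)) ≗ q²! n
qbin2-⊛ {n} {k} k≤n = begin
  qbin2 n k ⊛ D        ≈⟨ ⊛-congˡ D (qbin2-≤ k≤n) ⟩
  (q²! n ⊛ inv D) ⊛ D  ≈⟨ ⊛-assoc (q²! n) (inv D) D ⟩
  q²! n ⊛ (inv D ⊛ D)  ≈⟨ ⊛-congʳ (q²! n) (⊛-inverseˡ D D-at-0) ⟩
  q²! n ⊛ oneS         ≈⟨ ⊛-identityʳ (q²! n) ⟩
  q²! n                ∎
  where
  open ≗-Reasoning
  D = q²! k ⊛ q²! (n ∸ k)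
  D-at-0 : D 0 ≡ 1ℤ
  D-at-0 = trans (⊛-at-0 (q²! k) (q²! (n ∸ k))) (cong₂ _*_ (q²!-at-0 k) (q²!-at-0 (n ∸ k)))

qbin2-one : ∀ {n k} → k ≤ n → q²! k ⊛ q²! (n ∸ k) ≗ q²! n → qbin2 n k ≗ oneS
qbin2-one {n} {k} k≤n D≗q²!n = ≗-trans
  (x⊛a≗y⇒x≗y⊛a⁻¹ (q²! n) (qbin2 n k) (q²! n) (q²!-at-0 n) (≗-trans (⊛-congʳ (qbin2 n k) (≗-sym D≗q²!n)) (qbin2-⊛ k≤n)))
  (⊛-inverseʳ (q²! n) (q²!-at-0 n))

qbin2-n-0 : ∀ n → qbin2 n 0 ≗ oneS
qbin2-n-0 n = qbin2-one {n} {0} z≤n (⊛-identityˡ (q²! n))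

qbin2-n-n : ∀ n → qbin2 n n ≗ oneS
qbin2-n-n n = qbin2-one {n} {n} ℕₚ.≤-refl
  (≗-trans (⊛-congʳ (q²! n) (λ N → cong (λ k → q²! k N) (ℕₚ.n∸n≡0 n))) (⊛-identityʳ (q²! n)))

qbin2-pascal-< : ∀ ℓ s → let r = suc ℓ ℕ.+ s in
  qbin2 (suc r) (suc ℓ) ≗ qbin2 r (suc ℓ) ⊕ mono (2 ℕ.+ 2 ℕ.* s) ⊛ qbin2 r ℓ
qbin2-pascal-< ℓ s = ≗-trans (qbin2-≤ (ℕₚ.m≤n⇒m≤1+n (ℕₚ.m≤m+n (suc ℓ) s)))
  (≗-sym (x⊛a≗y⇒x≗y⊛a⁻¹ D (C₁ ⊕ y ⊛ C₀) (q²! (suc r)) D-at-0 clear-denominators))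
  where
  open ≗-Reasoning
  r = suc ℓ ℕ.+ s
  C₁ = qbin2 r (suc ℓ)
  C₀ = qbin2 r ℓ
  x = mono (2 ℕ.+ 2 ℕ.* ℓ)
  y = mono (2 ℕ.+ 2 ℕ.* s)
  D = q²! (suc ℓ) ⊛ q²! (suc r ∸ suc ℓ)
  r∸ℓ≡1+s : r ∸ ℓ ≡ suc s
  r∸ℓ≡1+s = trans (cong (_∸ ℓ) (sym (ℕₚ.+-suc ℓ s))) (ℕₚ.m+n∸m≡n ℓ (suc s))
  D-at-0 : D 0 ≡ 1ℤ
  D-at-0 = trans (⊛-at-0 (q²! (suc ℓ)) (q²! (suc r ∸ suc ℓ))) (cong₂ _*_ (q²!-at-0 (suc ℓ)) (q²!-at-0 (suc r ∸ suc ℓ)))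
  C₁-⊛ : C₁ ⊛ (q²! (suc ℓ) ⊛ q²! s) ≗ q²! r
  C₁-⊛ = ≗-trans (⊛-congʳ C₁ (⊛-congʳ (q²! (suc ℓ)) (λ N → cong (λ k → q²! k N) (sym (ℕₚ.m+n∸m≡n (suc ℓ) s)))))
                (qbin2-⊛ (ℕₚ.m≤m+n (suc ℓ) s))
  C₀-⊛ : C₀ ⊛ (q²! ℓ ⊛ q²! (suc s)) ≗ q²! r
  C₀-⊛ = ≗-trans (⊛-congʳ C₀ (⊛-congʳ (q²! ℓ) (λ N → cong (λ k → q²! k N) (sym r∸ℓ≡1+s))))
                (qbin2-⊛ (ℕₚ.≤-trans (ℕₚ.n≤1+n ℓ) (ℕₚ.m≤m+n (suc ℓ) s)))
  x⊛y : x ⊛ y ≗ mono (2 ℕ.+ 2 ℕ.* r)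
  x⊛y = ≗-trans (mono-+ _ _) (λ N → cong (λ k → mono k N) (exponent ℓ s))
    where
    exponent : ∀ ℓ s → 2 ℕ.+ 2 ℕ.* ℓ ℕ.+ (2 ℕ.+ 2 ℕ.* s) ≡ 2 ℕ.+ 2 ℕ.* (suc ℓ ℕ.+ s)
    exponent = solve-∀
  clear-denominators : (C₁ ⊕ y ⊛ C₀) ⊛ D ≗ q²! (suc r)
  clear-denominators = begin
    (C₁ ⊕ y ⊛ C₀) ⊛ D
      ≈⟨ ⊛-congʳ (C₁ ⊕ y ⊛ C₀) (⊛-cong (q²!-suc ℓ) (λ N → trans (cong (λ k → q²! k N) r∸ℓ≡1+s) (q²!-suc s N))) ⟩
    (C₁ ⊕ y ⊛ C₀) ⊛ ((q²! ℓ ⊛ (oneS ⊖ x)) ⊛ (q²! s ⊛ (oneS ⊖ y)))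
      ≈⟨ solve 6 (λ C₁ C₀ Qℓ Qs x y →
           (C₁ :+ y :* C₀) :* ((Qℓ :* (con 1ℤ :- x)) :* (Qs :* (con 1ℤ :- y)))
           := (C₁ :* ((Qℓ :* (con 1ℤ :- x)) :* Qs)) :* (con 1ℤ :- y) :+ y :* ((C₀ :* (Qℓ :* (Qs :* (con 1ℤ :- y)))) :* (con 1ℤ :- x)))
           ≗-refl C₁ C₀ (q²! ℓ) (q²! s) x y ⟩
    (C₁ ⊛ ((q²! ℓ ⊛ (oneS ⊖ x)) ⊛ q²! s)) ⊛ (oneS ⊖ y) ⊕ y ⊛ ((C₀ ⊛ (q²! ℓ ⊛ (q²! s ⊛ (oneS ⊖ y)))) ⊛ (oneS ⊖ x))
      ≈⟨ (λ N → cong₂ _+_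
           (⊛-congˡ (oneS ⊖ y) (≗-trans (⊛-congʳ C₁ (⊛-congˡ (q²! s) (≗-sym (q²!-suc ℓ)))) C₁-⊛) N)
           (⊛-congʳ y (⊛-congˡ (oneS ⊖ x) (≗-trans (⊛-congʳ C₀ (⊛-congʳ (q²! ℓ) (≗-sym (q²!-suc s)))) C₀-⊛)) N)) ⟩
    q²! r ⊛ (oneS ⊖ y) ⊕ y ⊛ (q²! r ⊛ (oneS ⊖ x))
      ≈⟨ solve 3 (λ Qr x y → Qr :* (con 1ℤ :- y) :+ y :* (Qr :* (con 1ℤ :- x)) := Qr :* (con 1ℤ :- x :* y)) ≗-refl (q²! r) x y ⟩
    q²! r ⊛ (oneS ⊖ x ⊛ y)
      ≈⟨ ⊛-congʳ (q²! r) (λ N → cong (λ v → oneS N - v) (x⊛y N)) ⟩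
    q²! r ⊛ (oneS ⊖ mono (2 ℕ.+ 2 ℕ.* r))
      ≈⟨ q²!-suc r ⟨
    q²! (suc r) ∎
    where open FPS-Solver

qbin2-pascal : ∀ r ℓ → qbin2 (suc r) (suc ℓ) ≗ qbin2 r (suc ℓ) ⊕ mono (2 ℕ.* (r ∸ ℓ)) ⊛ qbin2 r ℓ
qbin2-pascal r ℓ with ℕₚ.<-cmp ℓ r
... | tri< ℓ<r _ _ = pascal-< (r ∸ suc ℓ) (sym (ℕₚ.m+[n∸m]≡n ℓ<r))
  where
  pascal-< : ∀ s → r ≡ suc ℓ ℕ.+ s → qbin2 (suc r) (suc ℓ) ≗ qbin2 r (suc ℓ) ⊕ mono (2 ℕ.* (r ∸ ℓ)) ⊛ qbin2 r ℓ
  pascal-< s refl = ≗-trans (qbin2-pascal-< ℓ s) (λ N → cong (λ k → (qbin2 r (suc ℓ) ⊕ mono k ⊛ qbin2 r ℓ) N) exponent)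
    where
    exponent : 2 ℕ.+ 2 ℕ.* s ≡ 2 ℕ.* (r ∸ ℓ)
    exponent = trans (sym (ℕₚ.*-suc 2 s)) (cong (2 ℕ.*_) (sym (trans (cong (_∸ ℓ) (sym (ℕₚ.+-suc ℓ s))) (ℕₚ.m+n∸m≡n ℓ (suc s)))))
... | tri≈ _ refl _ = λ N → trans (qbin2-n-n (suc r) N) (sym (begin
  qbin2 r (suc r) N + (mono (2 ℕ.* (r ∸ r)) ⊛ qbin2 r r) N
    ≡⟨ cong₂ _+_ (qbin2-> (ℕₚ.n<1+n r) N) (⊛-cong (λ M → cong (λ k → mono (2 ℕ.* k) M) (ℕₚ.n∸n≡0 r)) (qbin2-n-n r) N) ⟩
  0ℤ + (oneS ⊛ oneS) N
    ≡⟨ trans (ℤₚ.+-identityˡ _) (⊛-identityˡ oneS N) ⟩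
  oneS N ∎))
  where open ≡-Reasoning
... | tri> _ _ r<ℓ = λ N → trans (qbin2-> (s≤s r<ℓ) N) (sym (cong₂ _+_
  (qbin2-> (ℕₚ.m<n⇒m<1+n r<ℓ) N)
  (trans (⊛-congʳ (mono (2 ℕ.* (r ∸ ℓ))) (qbin2-> r<ℓ) N) (⊛-zeroʳ (mono (2 ℕ.* (r ∸ ℓ))) N))))

sizeGF-progression : ∀ lo r ℓ →
  weightedGF (progression lo r) (λ ρ → mono ℓ (length ρ)) ≗ mono (sum (progression lo ℓ)) ⊛ qbin2 r ℓ
sizeGF-progression lo zero zero =
  ≗-trans (weightedGF-[] (λ ρ → mono 0 (length ρ))) (≗-sym (≗-trans (⊛-identityˡ (qbin2 0 0)) (qbin2-n-n 0)))
sizeGF-progression lo zero (suc ℓ) N =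
  sym (trans (⊛-congʳ q^S (qbin2-> {0} {suc ℓ} (s≤s z≤n)) N) (⊛-zeroʳ q^S N))
  where
  q^S = mono (sum (progression lo (suc ℓ)))
sizeGF-progression lo (suc r) zero = begin
  weightedGF (progression lo (suc r)) (λ ρ → mono 0 (length ρ))
    ≈⟨ weightedGF-∷ (lo ℕ.+ 2 ℕ.* r) (progression lo r) (λ ρ → mono 0 (length ρ)) ⟩
  mono (lo ℕ.+ 2 ℕ.* r) ⊛ weightedGF (progression lo r) (λ ρ → mono 0 (suc (length ρ)))
    ⊕ weightedGF (progression lo r) (λ ρ → mono 0 (length ρ))
    ≈⟨ (λ N → cong₂ _+_ (trans (⊛-congʳ (mono (lo ℕ.+ 2 ℕ.* r)) (weightedGF-zero (progression lo r) (λ _ _ → refl)) N)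
                               (⊛-zeroʳ (mono (lo ℕ.+ 2 ℕ.* r)) N))
                         (sizeGF-progression lo r zero N)) ⟩
  zeroS ⊕ oneS ⊛ qbin2 r 0
    ≈⟨ (λ N → trans (ℤₚ.+-identityˡ ((oneS ⊛ qbin2 r 0) N)) (⊛-congʳ oneS (≗-trans (qbin2-n-0 r) (≗-sym (qbin2-n-0 (suc r)))) N)) ⟩
  oneS ⊛ qbin2 (suc r) 0 ∎
  where open ≗-Reasoning
sizeGF-progression lo (suc r) (suc ℓ) = begin
  weightedGF (progression lo (suc r)) (λ ρ → mono (suc ℓ) (length ρ))
    ≈⟨ weightedGF-∷ (lo ℕ.+ 2 ℕ.* r) (progression lo r) (λ ρ → mono (suc ℓ) (length ρ)) ⟩
  a ⊛ weightedGF (progression lo r) (λ ρ → mono ℓ (length ρ)) ⊕ weightedGF (progression lo r) (λ ρ → mono (suc ℓ) (length ρ))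
    ≈⟨ (λ N → cong₂ _+_ (⊛-congʳ a (sizeGF-progression lo r ℓ) N) (sizeGF-progression lo r (suc ℓ) N)) ⟩
  a ⊛ (b ⊛ X) ⊕ c ⊛ Y
    ≈⟨ regroup ⟩
  c ⊛ (Y ⊕ d ⊛ X)
    ≈⟨ ⊛-congʳ c (qbin2-pascal r ℓ) ⟨
  c ⊛ qbin2 (suc r) (suc ℓ) ∎
  where
  open ≗-Reasoning
  a = mono (lo ℕ.+ 2 ℕ.* r)
  b = mono (sum (progression lo ℓ))
  c = mono (sum (progression lo (suc ℓ)))
  d = mono (2 ℕ.* (r ∸ ℓ))
  X = qbin2 r ℓ
  Y = qbin2 r (suc ℓ)
  ab⊛X≗cd⊛X : (a ⊛ b) ⊛ X ≗ (c ⊛ d) ⊛ X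
  ab⊛X≗cd⊛X with ℓ ℕ.≤? r
  ... | yes ℓ≤r = ⊛-congˡ X (≗-trans (mono-+ _ _) (≗-trans (λ N → cong (λ k → mono k N) exponent) (≗-sym (mono-+ _ _))))
    where
    shift : ∀ lo ℓ s S → lo ℕ.+ 2 ℕ.* (ℓ ℕ.+ s) ℕ.+ S ≡ lo ℕ.+ 2 ℕ.* ℓ ℕ.+ S ℕ.+ 2 ℕ.* s
    shift = solve-∀
    exponent : lo ℕ.+ 2 ℕ.* r ℕ.+ sum (progression lo ℓ) ≡ sum (progression lo (suc ℓ)) ℕ.+ 2 ℕ.* (r ∸ ℓ)
    exponent = trans (cong (λ k → lo ℕ.+ 2 ℕ.* k ℕ.+ _) (sym (ℕₚ.m+[n∸m]≡n ℓ≤r))) (shift lo ℓ (r ∸ ℓ) _)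
  ... | no ℓ≰r = ≗-trans (vanish (a ⊛ b)) (≗-sym (vanish (c ⊛ d)))
    where
    vanish : ∀ f → f ⊛ X ≗ zeroS
    vanish f = ≗-trans (⊛-congʳ f (qbin2-> (ℕₚ.≰⇒> ℓ≰r))) (⊛-zeroʳ f)
  regroup : a ⊛ (b ⊛ X) ⊕ c ⊛ Y ≗ c ⊛ (Y ⊕ d ⊛ X)
  regroup = begin
    a ⊛ (b ⊛ X) ⊕ c ⊛ Y  ≈⟨ (λ N → cong (_+ (c ⊛ Y) N) (trans (sym (⊛-assoc a b X N)) (ab⊛X≗cd⊛X N))) ⟩
    (c ⊛ d) ⊛ X ⊕ c ⊛ Y  ≈⟨ solve 4 (λ c d X Y → (c :* d) :* X :+ c :* Y := c :* (Y :+ d :* X)) ≗-refl c d X Y ⟩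
    c ⊛ (Y ⊕ d ⊛ X)      ∎
    where open FPS-Solver

-- Hooks

-- hookBox t ℓ j r rest is 1 exactly when the box in column j of a row of length r, above the rows rest, has
-- leg ℓ and hook length t: for j < r its hook length is (r ∸ j ∸ 1) + ℓ + 1, which is t iff r + ℓ = j + t.
-- For r ≤ j there is no such box, and the test r + ℓ = j + t fails anyway once ℓ < t.
hookBox : ℕ → ℕ → ℕ → ℕ → List ℕ → ℤ
hookBox t ℓ j r rest = mono (r ℕ.+ ℓ) (j ℕ.+ t) * mono ℓ (legBelow rest j)

hooksAt : ℕ → ℕ → ℕ → List ℕ → ℤ
hooksAt t ℓ j []         = 0ℤ
hooksAt t ℓ j (r ∷ rest) = hookBox t ℓ j r rest + hooksAt t ℓ j rest

countRow-sumTo : ∀ t r rest n →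
  ℤ.+ countRow t r rest n ≡ sumTo n (λ j → mono t ((r ∸ j ∸ 1) ℕ.+ legBelow rest j ℕ.+ 1))
countRow-sumTo t r rest zero    = refl
countRow-sumTo t r rest (suc n) =
  trans (ℤₚ.pos-+ (countRow t r rest n) _) (cong₂ _+_ (countRow-sumTo t r rest n) (indicator _))
  where
  indicator : ∀ b → ℤ.+ (if b then 1 else 0) ≡ (if b then 1ℤ else 0ℤ)
  indicator true  = refl
  indicator false = refl

sumTo-hookBox : ∀ t r j rest →
  sumTo t (λ ℓ → hookBox t ℓ j r rest) ≡ sumTo t (λ ℓ → mono (legBelow rest j) ℓ * mono (r ℕ.+ ℓ) (j ℕ.+ t))
sumTo-hookBox t r j rest = sumTo-cong t (λ ℓ →
  trans (ℤₚ.*-comm (mono (r ℕ.+ ℓ) (j ℕ.+ t)) _) (cong (_* mono (r ℕ.+ ℓ) (j ℕ.+ t)) (mono-sym ℓ (legBelow rest j))))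

sumTo-hookBox-< : ∀ t {j r} rest → j < r →
  sumTo t (λ ℓ → hookBox t ℓ j r rest) ≡ mono t ((r ∸ j ∸ 1) ℕ.+ legBelow rest j ℕ.+ 1)
sumTo-hookBox-< t {j} {r} rest j<r with legBelow rest j ℕ.<? t
... | yes L<t = trans (sumTo-hookBox t r j rest) (trans (sumTo-mono t L _ L<t)
      (mono-cong (λ j+t≡r+L → ℕₚ.+-cancelˡ-≡ j _ _ (trans j+hook≡r+L (sym j+t≡r+L)))
                 (λ hook≡t → trans (cong (j ℕ.+_) (sym hook≡t)) j+hook≡r+L)))
  where
  L = legBelow rest j
  s = r ∸ suc j
  arm≡s : r ∸ j ∸ 1 ≡ s
  arm≡s = trans (ℕₚ.∸-+-assoc r j 1) (cong (r ∸_) (ℕₚ.+-comm j 1))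
  shuffle : ∀ j s L → j ℕ.+ (s ℕ.+ L ℕ.+ 1) ≡ suc j ℕ.+ s ℕ.+ L
  shuffle = solve-∀
  j+hook≡r+L : j ℕ.+ ((r ∸ j ∸ 1) ℕ.+ L ℕ.+ 1) ≡ r ℕ.+ L
  j+hook≡r+L = trans (cong (λ x → j ℕ.+ (x ℕ.+ L ℕ.+ 1)) arm≡s)
                     (trans (shuffle j s L) (cong (ℕ._+ L) (ℕₚ.m+[n∸m]≡n j<r)))
... | no  L≮t = trans (sumTo-hookBox t r j rest) (trans (sumTo-mono-≥ t L _ (ℕₚ.≮⇒≥ L≮t))
      (sym (mono-≢ (ℕₚ.>⇒≢ (ℕₚ.≤-<-trans (ℕₚ.≮⇒≥ L≮t) L<hook)))))
  where
  L = legBelow rest j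
  L<hook : L < (r ∸ j ∸ 1) ℕ.+ L ℕ.+ 1
  L<hook = ℕₚ.≤-<-trans (ℕₚ.m≤n+m L (r ∸ j ∸ 1)) (ℕₚ.m<m+n _ (s≤s z≤n))

sumTo-hookBox-≥ : ∀ t {j r} rest → r ≤ j → sumTo t (λ ℓ → hookBox t ℓ j r rest) ≡ 0ℤ
sumTo-hookBox-≥ t {j} {r} rest r≤j with legBelow rest j ℕ.<? t
... | yes L<t = trans (sumTo-hookBox t r j rest)
      (trans (sumTo-mono t _ _ L<t) (mono-≢ (ℕₚ.>⇒≢ (ℕₚ.+-mono-≤-< r≤j L<t))))
... | no  L≮t = trans (sumTo-hookBox t r j rest) (sumTo-mono-≥ t _ _ (ℕₚ.≮⇒≥ L≮t))

countRow-hookBox : ∀ t r rest {B} → r ≤ B →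
  ℤ.+ countRow t r rest r ≡ sumTo t (λ ℓ → sumTo B (λ j → hookBox t ℓ j r rest))
countRow-hookBox t r rest {B} r≤B = sym (begin
  sumTo t (λ ℓ → sumTo B (λ j → hookBox t ℓ j r rest))   ≡⟨ sumTo-swap t B (λ ℓ j → hookBox t ℓ j r rest) ⟩
  sumTo B (λ j → sumTo t (λ ℓ → hookBox t ℓ j r rest))   ≡⟨ sumTo-trim _ r≤B (λ j → sumTo-hookBox-≥ t rest) ⟩
  sumTo r (λ j → sumTo t (λ ℓ → hookBox t ℓ j r rest))   ≡⟨ sumTo-cong-< r (λ j → sumTo-hookBox-< t rest) ⟩
  sumTo r (λ j → mono t ((r ∸ j ∸ 1) ℕ.+ legBelow rest j ℕ.+ 1)) ≡⟨ countRow-sumTo t r rest r ⟨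
  ℤ.+ countRow t r rest r                                 ∎)
  where open ≡-Reasoning

nHook-hooksAt : ∀ t μ {B} → All (_≤ B) μ → ℤ.+ nHook t μ ≡ sumTo t (λ ℓ → sumTo B (λ j → hooksAt t ℓ j μ))
nHook-hooksAt t []         {B} _ = sym (sumTo-zero t (λ _ _ → sumTo-zero B (λ _ _ → refl)))
nHook-hooksAt t (r ∷ rest) {B} (r≤B ∷ rest≤B) = begin
  ℤ.+ (countRow t r rest r ℕ.+ nHook t rest)
    ≡⟨ ℤₚ.pos-+ (countRow t r rest r) _ ⟩
  ℤ.+ countRow t r rest r + ℤ.+ nHook t rest
    ≡⟨ cong₂ _+_ (countRow-hookBox t r rest r≤B) (nHook-hooksAt t rest rest≤B) ⟩
  sumTo t (λ ℓ → sumTo B (λ j → hookBox t ℓ j r rest)) + sumTo t (λ ℓ → sumTo B (λ j → hooksAt t ℓ j rest))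
    ≡⟨ sumTo-distrib-+ t _ _ ⟨
  sumTo t (λ ℓ → sumTo B (λ j → hookBox t ℓ j r rest) + sumTo B (λ j → hooksAt t ℓ j rest))
    ≡⟨ sumTo-cong t (λ ℓ → sumTo-distrib-+ B _ _) ⟨
  sumTo t (λ ℓ → sumTo B (λ j → hooksAt t ℓ j (r ∷ rest))) ∎
  where open ≡-Reasoning

legBelow-++ : ∀ xs ys j → legBelow (xs ++ ys) j ≡ legBelow xs j ℕ.+ legBelow ys j
legBelow-++ xs ys j =
  trans (cong length (Listₚ.filter-++ (j ℕ.<?_) xs ys)) (Listₚ.length-++ (filter (j ℕ.<?_) xs))

legBelow-≤ : ∀ ys j → All (_≤ j) ys → legBelow ys j ≡ 0
legBelow-≤ ys j ys≤j = cong length (Listₚ.filter-none (j ℕ.<?_) (All.map ℕₚ.≤⇒≯ ys≤j))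

legBelow-> : ∀ ys j → All (j <_) ys → legBelow ys j ≡ length ys
legBelow-> ys j j<ys = cong length (Listₚ.filter-all (j ℕ.<?_) j<ys)

-- The only rows that can carry a box in column j with leg ℓ and hook length t have length a.
module HookRow (t ℓ j a : ℕ) (j+t≡a+ℓ : j ℕ.+ t ≡ a ℕ.+ ℓ) where

  hookBox-≢ : ∀ {x} rest → x ≢ a → hookBox t ℓ j x rest ≡ 0ℤ
  hookBox-≢ {x} rest x≢a = trans (cong (_* mono ℓ (legBelow rest j)) (mono-≢ j+t≢x+ℓ)) (ℤₚ.*-zeroˡ (mono ℓ (legBelow rest j)))
    where
    j+t≢x+ℓ : j ℕ.+ t ≢ x ℕ.+ ℓ
    j+t≢x+ℓ j+t≡x+ℓ = x≢a (ℕₚ.+-cancelʳ-≡ ℓ x a (trans (sym j+t≡x+ℓ) j+t≡a+ℓ))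

  hooksAt-none : ∀ xs → All (_≢ a) xs → hooksAt t ℓ j xs ≡ 0ℤ
  hooksAt-none []       []             = refl
  hooksAt-none (x ∷ xs) (x≢a ∷ xs≢a) = cong₂ _+_ (hookBox-≢ xs x≢a) (hooksAt-none xs xs≢a)

  hooksAt-skip : ∀ xs ys → All (_≢ a) xs → hooksAt t ℓ j (xs ++ ys) ≡ hooksAt t ℓ j ys
  hooksAt-skip []       ys []             = refl
  hooksAt-skip (x ∷ xs) ys (x≢a ∷ xs≢a) =
    trans (cong₂ _+_ (hookBox-≢ (xs ++ ys) x≢a) (hooksAt-skip xs ys xs≢a)) (ℤₚ.+-identityˡ _)

  hooksAt-drop : ∀ xs ys → All (_≤ j) ys → All (_≢ a) ys → hooksAt t ℓ j (xs ++ ys) ≡ hooksAt t ℓ j xs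
  hooksAt-drop []       ys ys≤j ys≢a = hooksAt-none ys ys≢a
  hooksAt-drop (x ∷ xs) ys ys≤j ys≢a = cong₂ _+_
    (cong (λ k → mono (x ℕ.+ ℓ) (j ℕ.+ t) * mono ℓ k)
          (trans (legBelow-++ xs ys j) (trans (cong (legBelow xs j ℕ.+_) (legBelow-≤ ys j ys≤j)) (ℕₚ.+-identityʳ _))))
    (hooksAt-drop xs ys ys≤j ys≢a)

  hooksAt-top : ∀ ρ → All (j <_) ρ → All (_≢ a) ρ → hooksAt t ℓ j (a ∷ ρ) ≡ mono ℓ (length ρ)
  hooksAt-top ρ j<ρ ρ≢a = begin
    mono (a ℕ.+ ℓ) (j ℕ.+ t) * mono ℓ (legBelow ρ j) + hooksAt t ℓ j ρ
      ≡⟨ cong₂ (λ x y → x * mono ℓ y + hooksAt t ℓ j ρ) (cong (mono (a ℕ.+ ℓ)) j+t≡a+ℓ) (legBelow-> ρ j j<ρ) ⟩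
    mono (a ℕ.+ ℓ) (a ℕ.+ ℓ) * mono ℓ (length ρ) + hooksAt t ℓ j ρ
      ≡⟨ cong₂ (λ x y → x * mono ℓ (length ρ) + y) (mono-refl (a ℕ.+ ℓ)) (hooksAt-none ρ ρ≢a) ⟩
    1ℤ * mono ℓ (length ρ) + 0ℤ
      ≡⟨ trans (ℤₚ.+-identityʳ _) (ℤₚ.*-identityˡ _) ⟩
    mono ℓ (length ρ) ∎
    where open ≡-Reasoning

hookGF-window : ∀ {t ℓ j} lo r → j ℕ.+ t ≡ lo ℕ.+ 2 ℕ.* r ℕ.+ ℓ → j < lo →
  weightedGF (progression lo (suc r)) (hooksAt t ℓ j) ≗ mono (lo ℕ.+ 2 ℕ.* r) ⊛ (mono (sum (progression lo ℓ)) ⊛ qbin2 r ℓ)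
hookGF-window {t} {ℓ} {j} lo r j+t≡a+ℓ j<lo = begin
  weightedGF (progression lo (suc r)) (hooksAt t ℓ j)
    ≈⟨ weightedGF-∷ a Inside (hooksAt t ℓ j) ⟩
  mono a ⊛ weightedGF Inside (λ ρ → hooksAt t ℓ j (a ∷ ρ)) ⊕ weightedGF Inside (hooksAt t ℓ j)
    ≈⟨ (λ N → cong₂ _+_
         (⊛-congʳ (mono a) (≗-trans (weightedGF-cong∈ Inside (λ ρ ρ∈ → H.hooksAt-top ρ (sublists-All Inside Inside>j ρ∈)
                                                                                      (sublists-All Inside Inside≢a ρ∈)))
                                     (sizeGF-progression lo r ℓ)) N)
         (weightedGF-zero Inside (λ ρ ρ∈ → H.hooksAt-none ρ (sublists-All Inside Inside≢a ρ∈)) N)) ⟩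
  M ⊕ zeroS
    ≈⟨ (λ N → ℤₚ.+-identityʳ (M N)) ⟩
  M ∎
  where
  open ≗-Reasoning
  a = lo ℕ.+ 2 ℕ.* r
  Inside = progression lo r
  M = mono a ⊛ (mono (sum (progression lo ℓ)) ⊛ qbin2 r ℓ)
  module H = HookRow t ℓ j a j+t≡a+ℓ
  Inside>j : All (j <_) Inside
  Inside>j = All.map (ℕₚ.<-≤-trans j<lo) (progression-≥ lo r)
  Inside≢a : All (_≢ a) Inside
  Inside≢a = All.map ℕₚ.<⇒≢ (progression-top lo r)

hookGF : ℕ → ℕ → ℕ → ℕ → FPS
hookGF K t ℓ j = weightedGF (progression 1 K) (hooksAt t ℓ j)

-- In column j = 2m + ε the only row with hook length t and leg ℓ has length a = 1 + 2d + 2r, where d = m + ε.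
-- The odd parts below 2K split into those above a, the window [1 + 2d, a] and those below j; only the window
-- feels the hook condition, so the factor (-q^(1+2d); q²)_(r+1) of (-q; q²)_K is replaced by hookGF-window.
hookGF-closed : ∀ {K t ℓ} ε r m → ε ≤ 1 → t ≡ ℓ ℕ.+ 2 ℕ.* r ℕ.+ suc ε → m ℕ.+ ε ℕ.+ suc r ≤ K →
  let d = m ℕ.+ ε in
  hookGF K t ℓ (2 ℕ.* m ℕ.+ ε) ≗
    (poch (negMono 1) 2 K ⊛ inv (poch (negMono (1 ℕ.+ 2 ℕ.* d)) 2 (suc r)))
    ⊛ (mono (1 ℕ.+ 2 ℕ.* d ℕ.+ 2 ℕ.* r) ⊛ (mono (sum (progression (1 ℕ.+ 2 ℕ.* d) ℓ)) ⊛ qbin2 r ℓ))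
hookGF-closed {K} {t} {ℓ} ε r m ε≤1 t≡ window≤K = begin
  weightedGF (progression 1 K) w
    ≈⟨ (λ N → cong (λ S → weightedGF S w N) parts) ⟩
  weightedGF (Above ++ (Window ++ Below)) w
    ≈⟨ weightedGF-++ Above (Window ++ Below) w (λ _ → 1ℤ) w
         (λ {μ} μ∈ _ → trans (H.hooksAt-skip μ _ (sublists-All Above Above≢a μ∈)) (sym (ℤₚ.*-identityˡ _))) ⟩
  subsetGF Above ⊛ weightedGF (Window ++ Below) w
    ≈⟨ ⊛-congʳ (subsetGF Above) (weightedGF-++ Window Below w w (λ _ → 1ℤ) (λ {μ} {ν} _ ν∈ →
         trans (H.hooksAt-drop μ ν (sublists-All Below Below≤j ν∈) (sublists-All Below Below≢a ν∈)) (sym (ℤₚ.*-identityʳ _)))) ⟩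
  subsetGF Above ⊛ (weightedGF Window w ⊛ subsetGF Below)
    ≈⟨ ⊛-congʳ (subsetGF Above) (⊛-congˡ (subsetGF Below) (hookGF-window (1 ℕ.+ 2 ℕ.* d) r j+t≡a+ℓ (s≤s j≤2d))) ⟩
  subsetGF Above ⊛ (M ⊛ subsetGF Below)
    ≈⟨ ⊛-replace-factor {P} {subsetGF Above} {subsetGF Below} {Wn} M (poch-at-0 (negMono (1 ℕ.+ 2 ℕ.* d)) 2 (suc r) refl) P-split ⟩
  (P ⊛ inv Wn) ⊛ M ∎
  where
  open ≗-Reasoning
  d = m ℕ.+ ε
  j = 2 ℕ.* m ℕ.+ ε
  a = 1 ℕ.+ 2 ℕ.* d ℕ.+ 2 ℕ.* r
  w = hooksAt t ℓ j
  Above = progression (1 ℕ.+ 2 ℕ.* (d ℕ.+ suc r)) (K ∸ (d ℕ.+ suc r))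
  Window = progression (1 ℕ.+ 2 ℕ.* d) (suc r)
  Below = progression 1 d
  P = poch (negMono 1) 2 K
  Wn = poch (negMono (1 ℕ.+ 2 ℕ.* d)) 2 (suc r)
  M = mono a ⊛ (mono (sum (progression (1 ℕ.+ 2 ℕ.* d) ℓ)) ⊛ qbin2 r ℓ)
  shift : ∀ m ε r ℓ → 2 ℕ.* m ℕ.+ ε ℕ.+ (ℓ ℕ.+ 2 ℕ.* r ℕ.+ suc ε) ≡ 1 ℕ.+ 2 ℕ.* (m ℕ.+ ε) ℕ.+ 2 ℕ.* r ℕ.+ ℓ
  shift = solve-∀
  j+t≡a+ℓ : j ℕ.+ t ≡ a ℕ.+ ℓ
  j+t≡a+ℓ = trans (cong (j ℕ.+_) t≡) (shift m ε r ℓ)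
  module H = HookRow t ℓ j a j+t≡a+ℓ
  2d≡j+ε : ∀ m ε → 2 ℕ.* (m ℕ.+ ε) ≡ 2 ℕ.* m ℕ.+ ε ℕ.+ ε
  2d≡j+ε = solve-∀
  j≤2d : j ≤ 2 ℕ.* d
  j≤2d = ℕₚ.≤-trans (ℕₚ.m≤m+n j ε) (ℕₚ.≤-reflexive (sym (2d≡j+ε m ε)))
  2d≤1+j : 2 ℕ.* d ≤ suc j
  2d≤1+j = ℕₚ.≤-trans (ℕₚ.≤-reflexive (2d≡j+ε m ε)) (ℕₚ.≤-trans (ℕₚ.+-monoʳ-≤ j ε≤1) (ℕₚ.≤-reflexive (ℕₚ.+-comm j 1)))
  parts : progression 1 K ≡ Above ++ (Window ++ Below)
  parts = trans (cong (progression 1) (sym (ℕₚ.m+[n∸m]≡n window≤K)))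
    (trans (progression-++ 1 (d ℕ.+ suc r) _) (cong (Above ++_) (progression-++ 1 d (suc r))))
  a<Above : ∀ d r → suc (1 ℕ.+ 2 ℕ.* d ℕ.+ 2 ℕ.* r) ≤ 1 ℕ.+ 2 ℕ.* (d ℕ.+ suc r)
  a<Above d r = ℕₚ.≤-trans (ℕₚ.n≤1+n _) (ℕₚ.≤-reflexive (a+2≡ d r))
    where
    a+2≡ : ∀ d r → suc (suc (1 ℕ.+ 2 ℕ.* d ℕ.+ 2 ℕ.* r)) ≡ 1 ℕ.+ 2 ℕ.* (d ℕ.+ suc r)
    a+2≡ = solve-∀
  Above≢a : All (_≢ a) Above
  Above≢a = All.map (λ lo≤x → ℕₚ.>⇒≢ (ℕₚ.<-≤-trans (a<Above d r) lo≤x)) (progression-≥ _ _)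
  Below≤j : All (_≤ j) Below
  Below≤j = All.map (λ x+2≤1+2d → ℕₚ.≤-pred (ℕₚ.≤-pred
              (ℕₚ.≤-trans (ℕₚ.≤-reflexive (ℕₚ.+-comm 2 _)) (ℕₚ.≤-trans x+2≤1+2d (s≤s 2d≤1+j)))))
            (progression-< 1 d)
  Below≢a : All (_≢ a) Below
  Below≢a = All.map (λ x<1+2d → ℕₚ.<⇒≢ (ℕₚ.<-≤-trans x<1+2d (ℕₚ.m≤m+n _ (2 ℕ.* r)))) (progression-top 1 d)
  P-split : P ≗ subsetGF Above ⊛ (Wn ⊛ subsetGF Below)
  P-split = ≗-trans (poch-subsetGF 1 K) (≗-trans (λ N → cong (λ S → subsetGF S N) parts)
    (≗-trans (subsetGF-++ Above (Window ++ Below))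
             (⊛-congʳ (subsetGF Above) (≗-trans (subsetGF-++ Window Below)
                                                 (⊛-congˡ (subsetGF Below) (≗-sym (poch-subsetGF (1 ℕ.+ 2 ℕ.* d) (suc r))))))))

hookGF-vanishing : ∀ {K t ℓ} ε r m → ε ≤ 1 → t ≡ ℓ ℕ.+ 2 ℕ.* r ℕ.+ suc ε → m ℕ.+ ε ℕ.+ suc r ≤ K → r < ℓ →
  hookGF K t ℓ (2 ℕ.* m ℕ.+ ε) ≗ zeroS
hookGF-vanishing {K} {t} {ℓ} ε r m ε≤1 t≡ window≤K r<ℓ = begin
  hookGF K t ℓ (2 ℕ.* m ℕ.+ ε)          ≈⟨ hookGF-closed ε r m ε≤1 t≡ window≤K ⟩
  C ⊛ (mono a ⊛ (mono S ⊛ qbin2 r ℓ))   ≈⟨ ⊛-congʳ C (⊛-congʳ (mono a) (⊛-congʳ (mono S) (qbin2-> r<ℓ))) ⟩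
  C ⊛ (mono a ⊛ (mono S ⊛ zeroS))       ≈⟨ ⊛-congʳ C (≗-trans (⊛-congʳ (mono a) (⊛-zeroʳ (mono S))) (⊛-zeroʳ (mono a))) ⟩
  C ⊛ zeroS                             ≈⟨ ⊛-zeroʳ C ⟩
  zeroS                                 ∎
  where
  open ≗-Reasoning
  d = m ℕ.+ ε
  a = 1 ℕ.+ 2 ℕ.* d ℕ.+ 2 ℕ.* r
  S = sum (progression (1 ℕ.+ 2 ℕ.* d) ℓ)
  C = poch (negMono 1) 2 K ⊛ inv (poch (negMono (1 ℕ.+ 2 ℕ.* d)) 2 (suc r))

-- Partitions into distinct odd parts

odd-progression : ∀ n → All (λ x → x % 2 ≡ 1) (progression 1 n)
odd-progression zero    = []
odd-progression (suc n) = trans (cong (λ k → (1 ℕ.+ k) % 2) (ℕₚ.*-comm 2 n)) (ℕ/.[m+kn]%n≡m%n 1 n 2) ∷ odd-progression n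

even-%2 : ∀ a → (2 ℕ.* a) % 2 ≡ 0
even-%2 a = trans (cong (_% 2) (ℕₚ.*-comm 2 a)) (ℕ/.m*n%n≡0 a 2)

[]∈sublists : (xs : List A) → [] ∈ sublists xs
[]∈sublists []       = here refl
[]∈sublists (x ∷ xs) = ∈ₚ.∈-++⁺ʳ (map (x ∷_) (sublists xs)) ([]∈sublists xs)

sublists-progression-unique : ∀ lo n → Unique (sublists (progression lo n))
sublists-progression-unique lo zero    = [] ∷ []
sublists-progression-unique lo (suc n) =
  Uniqueₚ.++⁺ (Uniqueₚ.map⁺ ∷-injectiveʳ (sublists-progression-unique lo n)) (sublists-progression-unique lo n) disjoint
  where
  x = lo ℕ.+ 2 ℕ.* n
  ∷-injectiveʳ : ∀ {μ ν : List ℕ} → x ∷ μ ≡ x ∷ ν → μ ≡ ν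
  ∷-injectiveʳ refl = refl
  disjoint : ∀ {μ} → ¬ (μ ∈ map (x ∷_) (sublists (progression lo n)) × μ ∈ sublists (progression lo n))
  disjoint (μ∈x∷ , μ∈) with ∈ₚ.∈-map⁻ (x ∷_) μ∈x∷
  ... | ν , _ , refl with sublists-All (progression lo n) (progression-top lo n) μ∈
  ...   | x<x ∷ _ = ℕₚ.<-irrefl refl x<x

sublists-progression-decreasing : ∀ lo n {μ} → μ ∈ sublists (progression lo n) → AllPairs _>_ μ
sublists-progression-decreasing lo zero    (here refl) = []
sublists-progression-decreasing lo (suc n) μ∈ with ∈ₚ.∈-++⁻ (map (lo ℕ.+ 2 ℕ.* n ∷_) (sublists (progression lo n))) μ∈
... | inj₂ μ∈′ = sublists-progression-decreasing lo n μ∈′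
... | inj₁ μ∈′ with ∈ₚ.∈-map⁻ (lo ℕ.+ 2 ℕ.* n ∷_) μ∈′
...   | ν , ν∈ , refl = sublists-All (progression lo n) (progression-top lo n) ν∈ ∷ sublists-progression-decreasing lo n ν∈

odd-below : ∀ K {y} → y % 2 ≡ 1 → y < 2 ℕ.+ 2 ℕ.* K → y ≢ 1 ℕ.+ 2 ℕ.* K → y < 2 ℕ.* K
odd-below K {y} y-odd y<2+2K y≢1+2K with ℕₚ.<-cmp y (2 ℕ.* K)
... | tri< y<2K _ _ = y<2K
... | tri≈ _ refl _ = ⊥-elim (ℕₚ.0≢1+n (trans (sym (even-%2 K)) y-odd))
... | tri> _ _ 2K<y with ℕₚ.m≤n⇒m<n∨m≡n (ℕₚ.≤-pred y<2+2K)
...   | inj₁ y<1+2K = ⊥-elim (ℕₚ.<⇒≱ 2K<y (ℕₚ.≤-pred y<1+2K))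
...   | inj₂ y≡1+2K = ⊥-elim (y≢1+2K y≡1+2K)

decreasing-odd-sublist : ∀ K {μ} → AllPairs _>_ μ → All (λ x → x % 2 ≡ 1) μ → All (_< 2 ℕ.* K) μ →
  μ ∈ sublists (progression 1 K)
decreasing-odd-sublist K       {[]}    _ _ _ = []∈sublists (progression 1 K)
decreasing-odd-sublist zero    {x ∷ μ} _ _ (() ∷ _)
decreasing-odd-sublist (suc K) {x ∷ μ} (x>μ ∷ μ-dec) (x-odd ∷ μ-odd) (x<2+2K ∷ μ<2+2K) with x ℕ.≟ 1 ℕ.+ 2 ℕ.* K
... | yes refl = ∈ₚ.∈-++⁺ˡ (∈ₚ.∈-map⁺ (x ∷_) (decreasing-odd-sublist K μ-dec μ-odd μ<2K))
  where
  μ<2K : All (_< 2 ℕ.* K) μ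
  μ<2K = All.zipWith (λ (y<x , y-odd) → odd-below K y-odd (ℕₚ.m<n⇒m<1+n y<x) (ℕₚ.<⇒≢ y<x)) (x>μ , μ-odd)
... | no x≢1+2K = ∈ₚ.∈-++⁺ʳ (map (1 ℕ.+ 2 ℕ.* K ∷_) (sublists (progression 1 K)))
    (decreasing-odd-sublist K (x>μ ∷ μ-dec) (x-odd ∷ μ-odd) (x<2K ∷ All.map (λ y<x → ℕₚ.<-trans y<x x<2K) x>μ))
  where
  x<2K : x < 2 ℕ.* K
  x<2K = odd-below K x-odd (ℕₚ.≤-trans x<2+2K (ℕₚ.≤-reflexive (ℕₚ.*-suc 2 K))) x≢1+2K

parts-≤-sum : ∀ μ → All (_≤ sum μ) μ
parts-≤-sum []      = []
parts-≤-sum (x ∷ μ) = ℕₚ.m≤m+n x (sum μ) ∷ All.map (λ y≤ → ℕₚ.≤-trans y≤ (ℕₚ.m≤n+m (sum μ) x)) (parts-≤-sum μ)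

DO-sublists : ∀ {n K} → n < K → ∀ p →
  (p ∈ filter (λ μ → sum μ ℕ.≟ n) (sublists (progression 1 K))) ⇔ IsDO n p
DO-sublists {n} {K} n<K p = mk⇔ to from
  where
  to : p ∈ filter (λ μ → sum μ ℕ.≟ n) (sublists (progression 1 K)) → IsDO n p
  to p∈ with ∈ₚ.∈-filter⁻ (λ μ → sum μ ℕ.≟ n) p∈
  ... | p∈S , sum≡n = Linkedₚ.AllPairs⇒Linked (sublists-progression-decreasing 1 K p∈S)
                    , sublists-All (progression 1 K) (odd-progression K) p∈S , sum≡n
  from : IsDO n p → p ∈ filter (λ μ → sum μ ℕ.≟ n) (sublists (progression 1 K))
  from (p-dec , p-odd , sum≡n) = ∈ₚ.∈-filter⁺ (λ μ → sum μ ℕ.≟ n)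
    (decreasing-odd-sublist K (Linkedₚ.Linked⇒AllPairs (λ y<x z<y → ℕₚ.<-trans z<y y<x) p-dec) p-odd p<2K) sum≡n
    where
    p<2K : All (_< 2 ℕ.* K) p
    p<2K = All.map (λ x≤sum → ℕₚ.≤-<-trans (ℕₚ.≤-trans x≤sum (ℕₚ.≤-reflexive sum≡n)) (ℕₚ.<-≤-trans n<K (ℕₚ.m≤m+n K (K ℕ.+ 0))))
                   (parts-≤-sum p)

+-sum-map : ∀ (f : A → ℕ) xs → ℤ.+ sum (map f xs) ≡ sumOver xs (λ x → ℤ.+ f x)
+-sum-map f []       = refl
+-sum-map f (x ∷ xs) = trans (ℤₚ.pos-+ (f x) _) (cong (ℤ.+ f x +_) (+-sum-map f xs))

sumOver-filter-sum : ∀ n (g : List ℕ → ℤ) xs →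
  sumOver (filter (λ μ → sum μ ℕ.≟ n) xs) g ≡ sumOver xs (λ μ → g μ * mono (sum μ) n)
sumOver-filter-sum n g []       = refl
sumOver-filter-sum n g (μ ∷ xs) with sum μ ℕ.≟ n
... | yes sum≡n = begin
  sumOver (filter (λ ν → sum ν ℕ.≟ n) (μ ∷ xs)) g           ≡⟨ cong (λ l → sumOver l g) (Listₚ.filter-accept _ {μ} {xs} sum≡n) ⟩
  g μ + sumOver (filter (λ ν → sum ν ℕ.≟ n) xs) g           ≡⟨ cong₂ _+_ g≡ (sumOver-filter-sum n g xs) ⟩
  g μ * mono (sum μ) n + sumOver xs (λ ν → g ν * mono (sum ν) n) ∎
  where
  open ≡-Reasoning
  g≡ : g μ ≡ g μ * mono (sum μ) n
  g≡ = sym (trans (cong (g μ *_) (trans (cong (mono (sum μ)) (sym sum≡n)) (mono-refl (sum μ)))) (ℤₚ.*-identityʳ (g μ)))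
... | no  sum≢n = begin
  sumOver (filter (λ ν → sum ν ℕ.≟ n) (μ ∷ xs)) g           ≡⟨ cong (λ l → sumOver l g) (Listₚ.filter-reject _ {μ} {xs} sum≢n) ⟩
  sumOver (filter (λ ν → sum ν ℕ.≟ n) xs) g                 ≡⟨ sumOver-filter-sum n g xs ⟩
  sumOver xs (λ ν → g ν * mono (sum ν) n)                   ≡⟨ ℤₚ.+-identityˡ _ ⟨
  0ℤ + sumOver xs (λ ν → g ν * mono (sum ν) n)              ≡⟨ cong (_+ _) (trans (cong (g μ *_) (mono-≢ (sum≢n ∘ sym))) (ℤₚ.*-zeroʳ (g μ))) ⟨
  g μ * mono (sum μ) n + sumOver xs (λ ν → g ν * mono (sum ν) n) ∎
  where open ≡-Reasoning

bstar-weightedGF : ∀ t {n K} → n < K → (L : List (List ℕ)) → Unique L → (∀ p → (p ∈ L) ⇔ IsDO n p) →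
  ℤ.+ sum (map (nHook t) L) ≡ weightedGF (progression 1 K) (λ μ → ℤ.+ nHook t μ) n
bstar-weightedGF t {n} {K} n<K L L-unique L≡DO = begin
  ℤ.+ sum (map (nHook t) L)       ≡⟨ cong ℤ.+_ (sumₚ.sum-↭ (↭ₚ.map⁺ (nHook t) L↭DO)) ⟩
  ℤ.+ sum (map (nHook t) DO)      ≡⟨ +-sum-map (nHook t) DO ⟩
  sumOver DO (λ μ → ℤ.+ nHook t μ) ≡⟨ sumOver-filter-sum n (λ μ → ℤ.+ nHook t μ) (sublists (progression 1 K)) ⟩
  weightedGF (progression 1 K) (λ μ → ℤ.+ nHook t μ) n ∎
  where
  open ≡-Reasoning
  DO = filter (λ μ → sum μ ℕ.≟ n) (sublists (progression 1 K))
  DO-unique : Unique DO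
  DO-unique = Uniqueₚ.filter⁺ (λ μ → sum μ ℕ.≟ n) (sublists-progression-unique 1 K)
  L↭DO : L ↭ DO
  L↭DO = ∼bag⇒↭ (unique∧set⇒bag L-unique DO-unique (λ {p} → mk⇔
    (Equivalence.from (DO-sublists n<K p) ∘ Equivalence.to (L≡DO p))
    (Equivalence.from (L≡DO p) ∘ Equivalence.to (DO-sublists n<K p))))

hookGF-absent : ∀ {K t ℓ j} a {n} → j ℕ.+ t ≡ a ℕ.+ ℓ →
  (∀ {μ} → μ ∈ sublists (progression 1 K) → sum μ ≡ n → All (_≢ a) μ) → hookGF K t ℓ j n ≡ 0ℤ
hookGF-absent {K} {t} {ℓ} {j} a {n} j+t≡a+ℓ a∉μ = sumOver-zero (sublists (progression 1 K)) term≡0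
  where
  term≡0 : ∀ μ → μ ∈ sublists (progression 1 K) → hooksAt t ℓ j μ * mono (sum μ) n ≡ 0ℤ
  term≡0 μ μ∈ with sum μ ℕ.≟ n
  ... | yes sum≡n = trans (cong (_* mono (sum μ) n) (HookRow.hooksAt-none t ℓ j a j+t≡a+ℓ μ (a∉μ μ∈ sum≡n))) (ℤₚ.*-zeroˡ (mono (sum μ) n))
  ... | no  sum≢n = trans (cong (hooksAt t ℓ j μ *_) (mono-≢ (sum≢n ∘ sym))) (ℤₚ.*-zeroʳ (hooksAt t ℓ j μ))

hookGF-even-row : ∀ {K t ℓ j} a {n} → j ℕ.+ t ≡ 2 ℕ.* a ℕ.+ ℓ → hookGF K t ℓ j n ≡ 0ℤ
hookGF-even-row {K} {t} {ℓ} {j} a {n} j+t≡2a+ℓ = hookGF-absent {K} {t} {ℓ} {j} (2 ℕ.* a) {n} j+t≡2a+ℓ (λ μ∈ _ →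
  All.map (λ x-odd x≡2a → ℕₚ.0≢1+n (trans (sym (even-%2 a)) (trans (cong (_% 2) (sym x≡2a)) x-odd)))
          (sublists-All (progression 1 K) (odd-progression K) μ∈))

hookGF-far-column : ∀ {K t ℓ j n} → ℓ < t → n ≤ j → hookGF K t ℓ j n ≡ 0ℤ
hookGF-far-column {K} {t} {ℓ} {j} {n} ℓ<t n≤j = hookGF-absent {K} {t} {ℓ} {j} (j ℕ.+ (t ∸ ℓ)) {n} j+t≡a+ℓ (λ {μ} _ sum≡n →
  All.map (λ x≤sum x≡a → ℕₚ.<⇒≱ j<a (subst (_≤ j) x≡a (ℕₚ.≤-trans x≤sum (ℕₚ.≤-trans (ℕₚ.≤-reflexive sum≡n) n≤j))))
          (parts-≤-sum μ))
  where
  j+t≡a+ℓ : j ℕ.+ t ≡ j ℕ.+ (t ∸ ℓ) ℕ.+ ℓ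
  j+t≡a+ℓ = trans (cong (j ℕ.+_) (sym (ℕₚ.m∸n+n≡m (ℕₚ.<⇒≤ ℓ<t)))) (sym (ℕₚ.+-assoc j (t ∸ ℓ) ℓ))
  j<a : j < j ℕ.+ (t ∸ ℓ)
  j<a = ℕₚ.m<m+n j (ℕₚ.m<n⇒0<n∸m ℓ<t)

weightedGF-nHook : ∀ t {n K} → n < K →
  weightedGF (progression 1 K) (λ μ → ℤ.+ nHook t μ) n ≡ sumTo t (λ ℓ → sumTo (2 ℕ.* suc n) (λ j → hookGF K t ℓ j n))
weightedGF-nHook t {n} {K} n<K = begin
  sumOver S (λ μ → ℤ.+ nHook t μ * mono (sum μ) n)
    ≡⟨ sumOver-cong∈ S (λ μ μ∈ → cong (_* mono (sum μ) n)
         (nHook-hooksAt t μ (All.map ℕₚ.≤-pred (sublists-All (progression 1 K) (progression-top 1 K) μ∈)))) ⟩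
  sumOver S (λ μ → sumTo t (λ ℓ → sumTo (2 ℕ.* K) (λ j → hooksAt t ℓ j μ)) * mono (sum μ) n)
    ≡⟨ sumOver-cong S (λ μ → trans (sumTo-*ʳ t (mono (sum μ) n) _) (sumTo-cong t (λ ℓ → sumTo-*ʳ (2 ℕ.* K) (mono (sum μ) n) _))) ⟩
  sumOver S (λ μ → sumTo t (λ ℓ → sumTo (2 ℕ.* K) (λ j → hooksAt t ℓ j μ * mono (sum μ) n)))
    ≡⟨ sumTo-sumOver t S _ ⟨
  sumTo t (λ ℓ → sumOver S (λ μ → sumTo (2 ℕ.* K) (λ j → hooksAt t ℓ j μ * mono (sum μ) n)))
    ≡⟨ sumTo-cong t (λ ℓ → sumTo-sumOver (2 ℕ.* K) S _) ⟨
  sumTo t (λ ℓ → sumTo (2 ℕ.* K) (λ j → hookGF K t ℓ j n))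
    ≡⟨ sumTo-cong-< t (λ ℓ ℓ<t → sumTo-trim _ (ℕₚ.*-monoʳ-≤ 2 n<K)
         (λ j 2+2n≤j → hookGF-far-column {K} {t} {ℓ} {j} {n} ℓ<t
           (ℕₚ.≤-trans (ℕₚ.m≤m+n n (suc n ℕ.+ 0)) (ℕₚ.≤-trans (ℕₚ.n≤1+n _) 2+2n≤j)))) ⟩
  sumTo t (λ ℓ → sumTo (2 ℕ.* suc n) (λ j → hookGF K t ℓ j n)) ∎
  where
  open ≡-Reasoning
  S = sublists (progression 1 K)

-- The right-hand side

poch-negMono-suc : ∀ lo d K {c} → c < lo ℕ.+ d ℕ.* K → poch (negMono lo) d (suc K) c ≡ poch (negMono lo) d K c
poch-negMono-suc lo d K {c} c<lo+dK = begin
  (P ⊛ (oneS ⊖ negMono lo ⊛ mono (d ℕ.* K))) c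
    ≡⟨ solve 3 (λ P m₁ m₂ → P :* (con 1ℤ :- (:- m₁) :* m₂) := P :+ (m₁ :* m₂) :* P) ≗-refl P (mono lo) (mono (d ℕ.* K)) c ⟩
  P c + ((mono lo ⊛ mono (d ℕ.* K)) ⊛ P) c
    ≡⟨ cong (P c +_) (trans (⊛-congˡ P (mono-+ lo (d ℕ.* K)) c) (mono-⊛-> P c<lo+dK)) ⟩
  P c + 0ℤ
    ≡⟨ ℤₚ.+-identityʳ (P c) ⟩
  P c ∎
  where
  open ≡-Reasoning
  open FPS-Solver
  P = poch (negMono lo) d K

pochInf-poch : ∀ {K c} → c < K → pochInf (negMono 1) 2 c ≡ poch (negMono 1) 2 K c
pochInf-poch {K} {c} c<K =
  trans (sym (stable (K ∸ suc c))) (cong (λ k → poch (negMono 1) 2 k c) (ℕₚ.m+[n∸m]≡n c<K))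
  where
  stable : ∀ s → poch (negMono 1) 2 (suc c ℕ.+ s) c ≡ pochInf (negMono 1) 2 c
  stable zero    = cong (λ k → poch (negMono 1) 2 k c) (ℕₚ.+-identityʳ (suc c))
  stable (suc s) = trans (cong (λ k → poch (negMono 1) 2 k c) (ℕₚ.+-suc (suc c) s))
                         (trans (poch-negMono-suc 1 2 (suc c ℕ.+ s) c<) (stable s))
    where
    c< : c < 1 ℕ.+ 2 ℕ.* (suc c ℕ.+ s)
    c< = s≤s (ℕₚ.≤-trans (ℕₚ.≤-trans (ℕₚ.n≤1+n c) (ℕₚ.m≤m+n (suc c) s)) (ℕₚ.m≤m+n _ _))

sumK-coefficient : ∀ f t b (F : ℕ → FPS) N →
  (f ⊛ sumK t b F) N ≡ sumTo (suc t) (λ k → if b k then (f ⊛ F k) N else 0ℤ)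
sumK-coefficient f t b F N = begin
  sumTo (suc N) (λ i → f i * sumTo (suc t) (λ k → if b k then F k (N ∸ i) else 0ℤ))
    ≡⟨ sumTo-cong (suc N) (λ i → trans (sumTo-*ˡ (suc t) (f i) _) (sumTo-cong (suc t) (λ k → *-if (b k) (f i) (F k (N ∸ i))))) ⟩
  sumTo (suc N) (λ i → sumTo (suc t) (λ k → if b k then f i * F k (N ∸ i) else 0ℤ))
    ≡⟨ sumTo-swap (suc N) (suc t) _ ⟩
  sumTo (suc t) (λ k → sumTo (suc N) (λ i → if b k then f i * F k (N ∸ i) else 0ℤ))
    ≡⟨ sumTo-cong (suc t) (λ k → sumTo-if (suc N) (b k) _) ⟩
  sumTo (suc t) (λ k → if b k then (f ⊛ F k) N else 0ℤ) ∎
  where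
  open ≡-Reasoning
  *-if : ∀ b x y → x * (if b then y else 0ℤ) ≡ (if b then x * y else 0ℤ)
  *-if true  x y = refl
  *-if false x y = ℤₚ.*-zeroʳ x

mSum-coefficient : ∀ f (G : ℕ → FPS) → (∀ m i → i < m → G m i ≡ 0ℤ) → ∀ N →
  (f ⊛ mSum G) N ≡ sumTo (suc N) (λ m → (f ⊛ G m) N)
mSum-coefficient f G G-order N = begin
  sumTo (suc N) (λ i → f i * sumTo (suc (N ∸ i)) (λ m → G m (N ∸ i)))
    ≡⟨ sumTo-cong-< (suc N) (λ i _ → cong (f i *_)
         (sym (sumTo-trim _ (s≤s (ℕₚ.m∸n≤m N i)) (λ m N∸i<m → G-order m (N ∸ i) N∸i<m)))) ⟩
  sumTo (suc N) (λ i → f i * sumTo (suc N) (λ m → G m (N ∸ i)))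
    ≡⟨ sumTo-cong (suc N) (λ i → sumTo-*ˡ (suc N) (f i) _) ⟩
  sumTo (suc N) (λ i → sumTo (suc N) (λ m → f i * G m (N ∸ i)))
    ≡⟨ sumTo-swap (suc N) (suc N) _ ⟩
  sumTo (suc N) (λ m → (f ⊛ G m) N) ∎
  where open ≡-Reasoning

-- K = n + t + 2 exceeds n, so that DO(n) consists of sublists of the odd numbers below 2K, and it leaves room
-- for every window d + r + 1 with d ≤ n + 1 and r < t met on the right-hand side.
cutoff : ℕ → ℕ → ℕ
cutoff t n = n ℕ.+ t ℕ.+ 2

n<cutoff : ∀ t n → n < cutoff t n
n<cutoff t n = ℕₚ.≤-trans (ℕₚ.m≤m+n (suc n) (t ℕ.+ 1)) (ℕₚ.≤-reflexive (shift n t))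
  where
  shift : ∀ n t → suc n ℕ.+ (t ℕ.+ 1) ≡ n ℕ.+ t ℕ.+ 2
  shift = solve-∀

-- The boxes of hook length t and leg ℓ in all partitions in DO(n), counted column by column; the columns
-- j ≥ n are empty, and the bound 2(n + 1) pairs the remaining ones as 2m, 2m + 1 with m ≤ n.
legSum : ℕ → ℕ → ℕ → ℤ
legSum t n ℓ = sumTo (2 ℕ.* suc n) (λ j → hookGF (cutoff t n) t ℓ j n)

legSum-parity : ∀ {t n ℓ} ε r → ε ≤ 1 → t ≡ ℓ ℕ.+ 2 ℕ.* r ℕ.+ suc ε →
  legSum t n ℓ ≡ sumTo (suc n) (λ m → hookGF (cutoff t n) t ℓ (2 ℕ.* m ℕ.+ ε) n)
legSum-parity {t} {n} {ℓ} .0 r z≤n t≡ = trans (sumTo-pairs (suc n) _) (sumTo-cong (suc n) (λ m →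
  trans (cong₂ _+_ (cong (λ j → hookGF (cutoff t n) t ℓ j n) (sym (ℕₚ.+-identityʳ (2 ℕ.* m))))
                   (hookGF-even-row {cutoff t n} {t} {ℓ} {2 ℕ.* m ℕ.+ 1} (m ℕ.+ suc r) {n} (trans (cong (2 ℕ.* m ℕ.+ 1 ℕ.+_) t≡) (odd-column m r ℓ))))
        (ℤₚ.+-identityʳ _)))
  where
  odd-column : ∀ m r ℓ → 2 ℕ.* m ℕ.+ 1 ℕ.+ (ℓ ℕ.+ 2 ℕ.* r ℕ.+ 1) ≡ 2 ℕ.* (m ℕ.+ suc r) ℕ.+ ℓ
  odd-column = solve-∀
legSum-parity {t} {n} {ℓ} .1 r (s≤s z≤n) t≡ = trans (sumTo-pairs (suc n) _) (sumTo-cong (suc n) (λ m →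
  trans (cong (_+ hookGF (cutoff t n) t ℓ (2 ℕ.* m ℕ.+ 1) n)
              (hookGF-even-row {cutoff t n} {t} {ℓ} {2 ℕ.* m} (m ℕ.+ suc r) {n} (trans (cong (2 ℕ.* m ℕ.+_) t≡) (even-column m r ℓ))))
        (ℤₚ.+-identityˡ _)))
  where
  even-column : ∀ m r ℓ → 2 ℕ.* m ℕ.+ (ℓ ℕ.+ 2 ℕ.* r ℕ.+ 2) ≡ 2 ℕ.* (m ℕ.+ suc r) ℕ.+ ℓ
  even-column = solve-∀

window≤cutoff : ∀ {t n ℓ} ε r {m} → ε ≤ 1 → m ≤ n → t ≡ ℓ ℕ.+ 2 ℕ.* r ℕ.+ suc ε → m ℕ.+ ε ℕ.+ suc r ≤ cutoff t n
window≤cutoff {t} {n} {ℓ} ε r {m} ε≤1 m≤n t≡ =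
  ℕₚ.≤-trans (ℕₚ.+-mono-≤ (ℕₚ.+-mono-≤ m≤n ε≤1) (s≤s r≤t)) (ℕₚ.≤-reflexive (shift n t))
  where
  shift : ∀ n t → n ℕ.+ 1 ℕ.+ suc t ≡ n ℕ.+ t ℕ.+ 2
  shift = solve-∀
  r≤ : ∀ ℓ r ε → ℓ ℕ.+ r ℕ.+ suc ε ℕ.+ r ≡ ℓ ℕ.+ 2 ℕ.* r ℕ.+ suc ε
  r≤ = solve-∀
  r≤t : r ≤ t
  r≤t = subst (r ≤_) (sym t≡) (ℕₚ.≤-trans (ℕₚ.m≤n+m r (ℓ ℕ.+ r ℕ.+ suc ε)) (ℕₚ.≤-reflexive (r≤ ℓ r ε)))

rhs-exponent : ∀ ε r ℓ m → let d = m ℕ.+ ε in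
  1 ℕ.+ 2 ℕ.* r ℕ.+ ℓ ℕ.* ℓ ℕ.+ 2 ℕ.* ε ℕ.* suc ℓ ℕ.+ 2 ℕ.* m ℕ.* suc ℓ
    ≡ 1 ℕ.+ 2 ℕ.* d ℕ.+ 2 ℕ.* r ℕ.+ sum (progression (1 ℕ.+ 2 ℕ.* d) ℓ)
rhs-exponent ε r ℓ m = ℕₚ.+-cancelʳ-≡ ℓ _ _ (begin
  E ℕ.+ e ℕ.+ ℓ                              ≡⟨ expand r ℓ ε m ⟩
  a ℕ.+ (ℓ ℕ.* (1 ℕ.+ 2 ℕ.* d) ℕ.+ ℓ ℕ.* ℓ)   ≡⟨ cong (a ℕ.+_) (sum-progression (1 ℕ.+ 2 ℕ.* d) ℓ) ⟨
  a ℕ.+ (S ℕ.+ ℓ)                            ≡⟨ ℕₚ.+-assoc a S ℓ ⟨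
  a ℕ.+ S ℕ.+ ℓ                              ∎)
  where
  open ≡-Reasoning
  d = m ℕ.+ ε
  E = 1 ℕ.+ 2 ℕ.* r ℕ.+ ℓ ℕ.* ℓ ℕ.+ 2 ℕ.* ε ℕ.* suc ℓ
  e = 2 ℕ.* m ℕ.* suc ℓ
  a = 1 ℕ.+ 2 ℕ.* d ℕ.+ 2 ℕ.* r
  S = sum (progression (1 ℕ.+ 2 ℕ.* d) ℓ)
  expand : ∀ r ℓ ε m → 1 ℕ.+ 2 ℕ.* r ℕ.+ ℓ ℕ.* ℓ ℕ.+ 2 ℕ.* ε ℕ.* suc ℓ ℕ.+ 2 ℕ.* m ℕ.* suc ℓ ℕ.+ ℓ
                     ≡ 1 ℕ.+ 2 ℕ.* (m ℕ.+ ε) ℕ.+ 2 ℕ.* r ℕ.+ (ℓ ℕ.* (1 ℕ.+ 2 ℕ.* (m ℕ.+ ε)) ℕ.+ ℓ ℕ.* ℓ)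
  expand = solve-∀

rhs-summand : ∀ {t n ℓ} ε r {m} → ε ≤ 1 → m ≤ n → t ≡ ℓ ℕ.+ 2 ℕ.* r ℕ.+ suc ε →
  ((pochInf (negMono 1) 2 ⊛ (mono (1 ℕ.+ 2 ℕ.* r ℕ.+ ℓ ℕ.* ℓ ℕ.+ 2 ℕ.* ε ℕ.* suc ℓ) ⊛ qbin2 r ℓ))
    ⊛ (mono (2 ℕ.* m ℕ.* suc ℓ) ⊛ inv (poch (negMono (2 ℕ.* m ℕ.+ (1 ℕ.+ 2 ℕ.* ε))) 2 (suc r)))) n
    ≡ hookGF (cutoff t n) t ℓ (2 ℕ.* m ℕ.+ ε) n
rhs-summand {t} {n} {ℓ} ε r {m} ε≤1 m≤n t≡ = begin
  ((P∞ ⊛ (mono E ⊛ qbin2 r ℓ)) ⊛ (mono e ⊛ inv W′)) n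
    ≡⟨ ⊛-congˡ-≤ (mono e ⊛ inv W′) n (λ i i≤n → ⊛-congˡ-≤ (mono E ⊛ qbin2 r ℓ) i (λ c c≤i →
         pochInf-poch (ℕₚ.≤-<-trans (ℕₚ.≤-trans c≤i i≤n) (n<cutoff t n)))) ⟩
  ((P ⊛ (mono E ⊛ qbin2 r ℓ)) ⊛ (mono e ⊛ inv W′)) n
    ≡⟨ solve 5 (λ P m₁ q m₂ I → (P :* (m₁ :* q)) :* (m₂ :* I) := (P :* I) :* ((m₁ :* m₂) :* q))
               ≗-refl P (mono E) (qbin2 r ℓ) (mono e) (inv W′) n ⟩
  ((P ⊛ inv W′) ⊛ ((mono E ⊛ mono e) ⊛ qbin2 r ℓ)) n
    ≡⟨ ⊛-congʳ (P ⊛ inv W′) (⊛-congˡ (qbin2 r ℓ) (mono-+ E e)) n ⟩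
  ((P ⊛ inv W′) ⊛ (mono (E ℕ.+ e) ⊛ qbin2 r ℓ)) n
    ≡⟨ cong₂ (λ x y → ((P ⊛ inv (poch (negMono x) 2 (suc r))) ⊛ (mono y ⊛ qbin2 r ℓ)) n) lo≡ (rhs-exponent ε r ℓ m) ⟩
  ((P ⊛ inv W) ⊛ (mono (a ℕ.+ S) ⊛ qbin2 r ℓ)) n
    ≡⟨ ⊛-congʳ (P ⊛ inv W) (≗-trans (⊛-congˡ (qbin2 r ℓ) (≗-sym (mono-+ a S))) (⊛-assoc (mono a) (mono S) (qbin2 r ℓ))) n ⟩
  ((P ⊛ inv W) ⊛ (mono a ⊛ (mono S ⊛ qbin2 r ℓ))) n
    ≡⟨ hookGF-closed ε r m ε≤1 t≡ (window≤cutoff {t} {n} {ℓ} ε r ε≤1 m≤n t≡) n ⟨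
  hookGF (cutoff t n) t ℓ (2 ℕ.* m ℕ.+ ε) n ∎
  where
  open ≡-Reasoning
  open FPS-Solver
  P∞ = pochInf (negMono 1) 2
  P = poch (negMono 1) 2 (cutoff t n)
  d = m ℕ.+ ε
  E = 1 ℕ.+ 2 ℕ.* r ℕ.+ ℓ ℕ.* ℓ ℕ.+ 2 ℕ.* ε ℕ.* suc ℓ
  e = 2 ℕ.* m ℕ.* suc ℓ
  a = 1 ℕ.+ 2 ℕ.* d ℕ.+ 2 ℕ.* r
  S = sum (progression (1 ℕ.+ 2 ℕ.* d) ℓ)
  W′ = poch (negMono (2 ℕ.* m ℕ.+ (1 ℕ.+ 2 ℕ.* ε))) 2 (suc r)
  W = poch (negMono (1 ℕ.+ 2 ℕ.* d)) 2 (suc r)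
  lo≡ : 2 ℕ.* m ℕ.+ (1 ℕ.+ 2 ℕ.* ε) ≡ 1 ℕ.+ 2 ℕ.* d
  lo≡ = shift m ε
    where
    shift : ∀ m ε → 2 ℕ.* m ℕ.+ (1 ℕ.+ 2 ℕ.* ε) ≡ 1 ℕ.+ 2 ℕ.* (m ℕ.+ ε)
    shift = solve-∀

-- A term of one of the four k-sums on the right-hand side, with guard b, exponent E, q-binomial [R, ℓ],
-- step q^(2mc) and denominator (-q^(2m+lo); q²)_W, is the leg-ℓ part of the left-hand side when its
-- parameters have the following shape.
record TermShape (t ℓ : ℕ) (b : Bool) (E R W c lo : ℕ) : Set where
  field
    ε r   : ℕ
    ε≤1   : ε ≤ 1
    t≡    : t ≡ ℓ ℕ.+ 2 ℕ.* r ℕ.+ suc ε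
    E≡    : E ≡ 1 ℕ.+ 2 ℕ.* r ℕ.+ ℓ ℕ.* ℓ ℕ.+ 2 ℕ.* ε ℕ.* suc ℓ
    R≡    : R ≡ r
    W≡    : W ≡ suc r
    c≡    : c ≡ suc ℓ
    lo≡   : lo ≡ 1 ℕ.+ 2 ℕ.* ε
    guard : b ≡ false → r < ℓ

rhs-block : ∀ {t n ℓ b E R W c lo} → TermShape t ℓ b E R W c lo →
  (if b then sumTo (suc n) (λ m → ((pochInf (negMono 1) 2 ⊛ (mono E ⊛ qbin2 R ℓ))
                                     ⊛ (mono (2 ℕ.* m ℕ.* c) ⊛ inv (poch (negMono (2 ℕ.* m ℕ.+ lo)) 2 W))) n)
        else 0ℤ)
    ≡ legSum t n ℓ
rhs-block {t} {n} {ℓ} {b = true}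
  record { ε = ε ; r = r ; ε≤1 = ε≤1 ; t≡ = t≡ ; E≡ = refl ; R≡ = refl ; W≡ = refl ; c≡ = refl ; lo≡ = refl } =
  trans (sumTo-cong-< (suc n) (λ m m<1+n → rhs-summand {t} {n} {ℓ} ε r ε≤1 (ℕₚ.≤-pred m<1+n) t≡))
        (sym (legSum-parity {t} {n} {ℓ} ε r ε≤1 t≡))
rhs-block {t} {n} {ℓ} {b = false}
  record { ε = ε ; r = r ; ε≤1 = ε≤1 ; t≡ = t≡ ; guard = guard } =
  sym (trans (legSum-parity {t} {n} {ℓ} ε r ε≤1 t≡) (sumTo-zero (suc n) (λ m m<1+n →
    hookGF-vanishing ε r m ε≤1 t≡ (window≤cutoff {t} {n} {ℓ} ε r ε≤1 (ℕₚ.≤-pred m<1+n) t≡) (guard refl) n)))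

rhs-family : ∀ {t n h} {b : ℕ → Bool} {Y : ℕ → FPS} {c : ℕ → ℕ} {Z : ℕ → ℕ → FPS} (ℓ : ℕ → ℕ) →
  h ≤ suc t → (∀ k → 1 ≤ c k) → (∀ k → h ≤ k → b k ≡ false) →
  (∀ k → k < h →
    (if b k then sumTo (suc n) (λ m → ((pochInf (negMono 1) 2 ⊛ Y k) ⊛ (mono (2 ℕ.* m ℕ.* c k) ⊛ Z k m)) n) else 0ℤ)
      ≡ legSum t n (ℓ k)) →
  (pochInf (negMono 1) 2 ⊛ sumK t b (λ k → Y k ⊛ mSum (λ m → mono (2 ℕ.* m ℕ.* c k) ⊛ Z k m))) n
    ≡ sumTo h (λ k → legSum t n (ℓ k))
rhs-family {t} {n} {h} {b} {Y} {c} {Z} ℓ h≤1+t c≥1 guard-beyond block = begin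
  (P∞ ⊛ sumK t b (λ k → Y k ⊛ mSum (M k))) n
    ≡⟨ sumK-coefficient P∞ t b (λ k → Y k ⊛ mSum (M k)) n ⟩
  sumTo (suc t) (λ k → if b k then (P∞ ⊛ (Y k ⊛ mSum (M k))) n else 0ℤ)
    ≡⟨ sumTo-cong (suc t) (λ k → cong (λ x → if b k then x else 0ℤ)
         (trans (sym (⊛-assoc P∞ (Y k) (mSum (M k)) n)) (mSum-coefficient (P∞ ⊛ Y k) (M k) (M-order k) n))) ⟩
  sumTo (suc t) X
    ≡⟨ sumTo-trim X h≤1+t (λ k h≤k →
         cong (λ x → if x then sumTo (suc n) (λ m → ((P∞ ⊛ Y k) ⊛ M k m) n) else 0ℤ) (guard-beyond k h≤k)) ⟩
  sumTo h X
    ≡⟨ sumTo-cong-< h block ⟩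
  sumTo h (λ k → legSum t n (ℓ k)) ∎
  where
  open ≡-Reasoning
  P∞ = pochInf (negMono 1) 2
  M : ℕ → ℕ → FPS
  M k m = mono (2 ℕ.* m ℕ.* c k) ⊛ Z k m
  X : ℕ → ℤ
  X k = if b k then sumTo (suc n) (λ m → ((P∞ ⊛ Y k) ⊛ M k m) n) else 0ℤ
  M-order : ∀ k m i → i < m → M k m i ≡ 0ℤ
  M-order k m i i<m = mono-⊛-> (Z k m) (ℕₚ.<-≤-trans i<m m≤2mc)
    where
    m≤2mc : m ≤ 2 ℕ.* m ℕ.* c k
    m≤2mc = ℕₚ.≤-trans (ℕₚ.m≤m+n m (m ℕ.+ 0))
              (ℕₚ.≤-trans (ℕₚ.≤-reflexive (sym (ℕₚ.*-identityʳ (2 ℕ.* m)))) (ℕₚ.*-monoʳ-≤ (2 ℕ.* m) (c≥1 k)))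

half-double : ∀ s → (2 ℕ.* s) / 2 ≡ s
half-double s = trans (cong (_/ 2) (ℕₚ.*-comm 2 s)) (ℕ/.m*n/n≡m s 2)

∸-half : ∀ {x} b s → x ≡ b ℕ.+ 2 ℕ.* s → (x ∸ b) / 2 ≡ s
∸-half b s refl = trans (cong (_/ 2) (ℕₚ.m+n∸m≡n b (2 ℕ.* s))) (half-double s)

∸∸-half : ∀ {x} b c s → x ≡ b ℕ.+ c ℕ.+ 2 ℕ.* s → (x ∸ b ∸ c) / 2 ≡ s
∸∸-half {x} b c s x≡ = trans (cong (_/ 2) (ℕₚ.∸-+-assoc x b c)) (∸-half (b ℕ.+ c) s x≡)

≤ᵇ-false⇒> : ∀ {bound t ℓ r} → (ℓ ≤ r → bound ≤ t) → (bound ≤ᵇ t) ≡ false → r < ℓ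
≤ᵇ-false⇒> bound≤t eq = ℕₚ.≰⇒> (λ ℓ≤r → subst T eq (ℕₚ.≤⇒≤ᵇ (bound≤t ℓ≤r)))

>⇒≤ᵇ-false : ∀ {bound t} → t < bound → (bound ≤ᵇ t) ≡ false
>⇒≤ᵇ-false {bound} {t} t<bound with bound ≤ᵇ t | ℕₚ.≤ᵇ⇒≤ bound t
... | false | _       = refl
... | true  | bound≤t = ⊥-elim (ℕₚ.<⇒≱ t<bound (bound≤t _))

even-shape₁ : ∀ {t} k s → t ≡ 2 ℕ.* (suc k ℕ.+ s) →
  TermShape t (2 ℕ.* k ℕ.+ 1) (6 ℕ.* k ℕ.+ 4 ≤ᵇ t) (t ℕ.+ 4 ℕ.* k ℕ.* k ℕ.+ 2 ℕ.* k)
            ((t ∸ 2 ℕ.* k ∸ 2) / 2) ((t ∸ 2 ℕ.* k) / 2) (2 ℕ.* k ℕ.+ 2) 1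
even-shape₁ k s refl = record
  { ε = 0 ; r = s ; ε≤1 = z≤n ; t≡ = t≡ k s ; E≡ = E≡ k s
  ; R≡ = ∸∸-half (2 ℕ.* k) 2 s (R≡ k s) ; W≡ = ∸-half (2 ℕ.* k) (suc s) (W≡ k s) ; c≡ = c≡ k ; lo≡ = refl
  ; guard = ≤ᵇ-false⇒> (λ ℓ≤s → ℕₚ.≤-trans (ℕₚ.≤-reflexive (bound≡ k)) (ℕₚ.*-monoʳ-≤ 2 (ℕₚ.+-monoʳ-≤ (suc k) ℓ≤s)))
  }
  where
  t≡ : ∀ k s → 2 ℕ.* (suc k ℕ.+ s) ≡ 2 ℕ.* k ℕ.+ 1 ℕ.+ 2 ℕ.* s ℕ.+ 1
  t≡ = solve-∀
  E≡ : ∀ k s → 2 ℕ.* (suc k ℕ.+ s) ℕ.+ 4 ℕ.* k ℕ.* k ℕ.+ 2 ℕ.* k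
             ≡ 1 ℕ.+ 2 ℕ.* s ℕ.+ (2 ℕ.* k ℕ.+ 1) ℕ.* (2 ℕ.* k ℕ.+ 1) ℕ.+ 2 ℕ.* 0 ℕ.* suc (2 ℕ.* k ℕ.+ 1)
  E≡ = solve-∀
  R≡ : ∀ k s → 2 ℕ.* (suc k ℕ.+ s) ≡ 2 ℕ.* k ℕ.+ 2 ℕ.+ 2 ℕ.* s
  R≡ = solve-∀
  W≡ : ∀ k s → 2 ℕ.* (suc k ℕ.+ s) ≡ 2 ℕ.* k ℕ.+ 2 ℕ.* suc s
  W≡ = solve-∀
  c≡ : ∀ k → 2 ℕ.* k ℕ.+ 2 ≡ suc (2 ℕ.* k ℕ.+ 1)
  c≡ = solve-∀
  bound≡ : ∀ k → 6 ℕ.* k ℕ.+ 4 ≡ 2 ℕ.* (suc k ℕ.+ (2 ℕ.* k ℕ.+ 1))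
  bound≡ = solve-∀

even-shape₂ : ∀ {t} k s → t ≡ 2 ℕ.* (suc k ℕ.+ s) →
  TermShape t (2 ℕ.* k) (6 ℕ.* k ℕ.+ 2 ≤ᵇ t) (t ℕ.+ 4 ℕ.* k ℕ.* k ℕ.+ 2 ℕ.* k ℕ.+ 1)
            ((t ∸ 2 ℕ.* k ∸ 2) / 2) ((t ∸ 2 ℕ.* k) / 2) (2 ℕ.* k ℕ.+ 1) 3
even-shape₂ k s refl = record
  { ε = 1 ; r = s ; ε≤1 = s≤s z≤n ; t≡ = t≡ k s ; E≡ = E≡ k s
  ; R≡ = ∸∸-half (2 ℕ.* k) 2 s (R≡ k s) ; W≡ = ∸-half (2 ℕ.* k) (suc s) (W≡ k s) ; c≡ = c≡ k ; lo≡ = refl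
  ; guard = ≤ᵇ-false⇒> (λ ℓ≤s → ℕₚ.≤-trans (ℕₚ.≤-reflexive (bound≡ k)) (ℕₚ.*-monoʳ-≤ 2 (ℕₚ.+-monoʳ-≤ (suc k) ℓ≤s)))
  }
  where
  t≡ : ∀ k s → 2 ℕ.* (suc k ℕ.+ s) ≡ 2 ℕ.* k ℕ.+ 2 ℕ.* s ℕ.+ 2
  t≡ = solve-∀
  E≡ : ∀ k s → 2 ℕ.* (suc k ℕ.+ s) ℕ.+ 4 ℕ.* k ℕ.* k ℕ.+ 2 ℕ.* k ℕ.+ 1
             ≡ 1 ℕ.+ 2 ℕ.* s ℕ.+ 2 ℕ.* k ℕ.* (2 ℕ.* k) ℕ.+ 2 ℕ.* 1 ℕ.* suc (2 ℕ.* k)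
  E≡ = solve-∀
  R≡ : ∀ k s → 2 ℕ.* (suc k ℕ.+ s) ≡ 2 ℕ.* k ℕ.+ 2 ℕ.+ 2 ℕ.* s
  R≡ = solve-∀
  W≡ : ∀ k s → 2 ℕ.* (suc k ℕ.+ s) ≡ 2 ℕ.* k ℕ.+ 2 ℕ.* suc s
  W≡ = solve-∀
  c≡ : ∀ k → 2 ℕ.* k ℕ.+ 1 ≡ suc (2 ℕ.* k)
  c≡ = solve-∀
  bound≡ : ∀ k → 6 ℕ.* k ℕ.+ 2 ≡ 2 ℕ.* (suc k ℕ.+ 2 ℕ.* k)
  bound≡ = solve-∀

odd-shape₁ : ∀ {t} k s → t ≡ 2 ℕ.* (k ℕ.+ s) ℕ.+ 1 →
  TermShape t (2 ℕ.* k) (6 ℕ.* k ℕ.+ 1 ≤ᵇ t) (t ℕ.+ 4 ℕ.* k ℕ.* k ∸ 2 ℕ.* k)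
            ((t ∸ 2 ℕ.* k ∸ 1) / 2) ((t ∸ 2 ℕ.* k ℕ.+ 1) / 2) (2 ℕ.* k ℕ.+ 1) 1
odd-shape₁ k s refl = record
  { ε = 0 ; r = s ; ε≤1 = z≤n ; t≡ = t≡ k s
  ; E≡ = trans (cong (_∸ 2 ℕ.* k) (E+2k≡ k s)) (ℕₚ.m+n∸n≡m _ (2 ℕ.* k))
  ; R≡ = ∸∸-half (2 ℕ.* k) 1 s (R≡ k s)
  ; W≡ = trans (cong (λ x → (x ℕ.+ 1) / 2) (trans (cong (_∸ 2 ℕ.* k) (split k s)) (ℕₚ.m+n∸m≡n (2 ℕ.* k) (1 ℕ.+ 2 ℕ.* s))))
               (trans (cong (_/ 2) (W≡ s)) (half-double (suc s)))
  ; c≡ = c≡ k ; lo≡ = refl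
  ; guard = ≤ᵇ-false⇒> (λ ℓ≤s → ℕₚ.≤-trans (ℕₚ.≤-reflexive (bound≡ k)) (ℕₚ.+-monoˡ-≤ 1 (ℕₚ.*-monoʳ-≤ 2 (ℕₚ.+-monoʳ-≤ k ℓ≤s))))
  }
  where
  t≡ : ∀ k s → 2 ℕ.* (k ℕ.+ s) ℕ.+ 1 ≡ 2 ℕ.* k ℕ.+ 2 ℕ.* s ℕ.+ 1
  t≡ = solve-∀
  E+2k≡ : ∀ k s → 2 ℕ.* (k ℕ.+ s) ℕ.+ 1 ℕ.+ 4 ℕ.* k ℕ.* k
                ≡ 1 ℕ.+ 2 ℕ.* s ℕ.+ 2 ℕ.* k ℕ.* (2 ℕ.* k) ℕ.+ 2 ℕ.* 0 ℕ.* suc (2 ℕ.* k) ℕ.+ 2 ℕ.* k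
  E+2k≡ = solve-∀
  R≡ : ∀ k s → 2 ℕ.* (k ℕ.+ s) ℕ.+ 1 ≡ 2 ℕ.* k ℕ.+ 1 ℕ.+ 2 ℕ.* s
  R≡ = solve-∀
  split : ∀ k s → 2 ℕ.* (k ℕ.+ s) ℕ.+ 1 ≡ 2 ℕ.* k ℕ.+ (1 ℕ.+ 2 ℕ.* s)
  split = solve-∀
  W≡ : ∀ s → 1 ℕ.+ 2 ℕ.* s ℕ.+ 1 ≡ 2 ℕ.* suc s
  W≡ = solve-∀
  c≡ : ∀ k → 2 ℕ.* k ℕ.+ 1 ≡ suc (2 ℕ.* k)
  c≡ = solve-∀
  bound≡ : ∀ k → 6 ℕ.* k ℕ.+ 1 ≡ 2 ℕ.* (k ℕ.+ 2 ℕ.* k) ℕ.+ 1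
  bound≡ = solve-∀

odd-shape₂ : ∀ {t} k s → t ≡ 2 ℕ.* (suc k ℕ.+ s) ℕ.+ 1 →
  TermShape t (2 ℕ.* k ℕ.+ 1) (6 ℕ.* k ℕ.+ 5 ≤ᵇ t) (t ℕ.+ 4 ℕ.* k ℕ.* k ℕ.+ 6 ℕ.* k ℕ.+ 3)
            ((t ∸ 2 ℕ.* k ∸ 3) / 2) ((t ∸ 2 ℕ.* k ∸ 1) / 2) (2 ℕ.* k ℕ.+ 2) 3
odd-shape₂ k s refl = record
  { ε = 1 ; r = s ; ε≤1 = s≤s z≤n ; t≡ = t≡ k s ; E≡ = E≡ k s
  ; R≡ = ∸∸-half (2 ℕ.* k) 3 s (R≡ k s) ; W≡ = ∸∸-half (2 ℕ.* k) 1 (suc s) (W≡ k s) ; c≡ = c≡ k ; lo≡ = refl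
  ; guard = ≤ᵇ-false⇒> (λ ℓ≤s → ℕₚ.≤-trans (ℕₚ.≤-reflexive (bound≡ k)) (ℕₚ.+-monoˡ-≤ 1 (ℕₚ.*-monoʳ-≤ 2 (ℕₚ.+-monoʳ-≤ (suc k) ℓ≤s))))
  }
  where
  t≡ : ∀ k s → 2 ℕ.* (suc k ℕ.+ s) ℕ.+ 1 ≡ 2 ℕ.* k ℕ.+ 1 ℕ.+ 2 ℕ.* s ℕ.+ 2
  t≡ = solve-∀
  E≡ : ∀ k s → 2 ℕ.* (suc k ℕ.+ s) ℕ.+ 1 ℕ.+ 4 ℕ.* k ℕ.* k ℕ.+ 6 ℕ.* k ℕ.+ 3
             ≡ 1 ℕ.+ 2 ℕ.* s ℕ.+ (2 ℕ.* k ℕ.+ 1) ℕ.* (2 ℕ.* k ℕ.+ 1) ℕ.+ 2 ℕ.* 1 ℕ.* suc (2 ℕ.* k ℕ.+ 1)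
  E≡ = solve-∀
  R≡ : ∀ k s → 2 ℕ.* (suc k ℕ.+ s) ℕ.+ 1 ≡ 2 ℕ.* k ℕ.+ 3 ℕ.+ 2 ℕ.* s
  R≡ = solve-∀
  W≡ : ∀ k s → 2 ℕ.* (suc k ℕ.+ s) ℕ.+ 1 ≡ 2 ℕ.* k ℕ.+ 1 ℕ.+ 2 ℕ.* suc s
  W≡ = solve-∀
  c≡ : ∀ k → 2 ℕ.* k ℕ.+ 2 ≡ suc (2 ℕ.* k ℕ.+ 1)
  c≡ = solve-∀
  bound≡ : ∀ k → 6 ℕ.* k ℕ.+ 5 ≡ 2 ℕ.* (suc k ℕ.+ (2 ℕ.* k ℕ.+ 1)) ℕ.+ 1
  bound≡ = solve-∀

2h≤6k : ∀ {h k} → h ≤ k → 2 ℕ.* h ≤ 6 ℕ.* k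
2h≤6k {h} {k} h≤k = ℕₚ.≤-trans (ℕₚ.*-monoʳ-≤ 2 h≤k) (ℕₚ.*-monoˡ-≤ k (s≤s (s≤s (z≤n {4}))))

rhsEven-legSums : ∀ h n → rhsEven (2 ℕ.* h) n ≡ sumTo (2 ℕ.* h) (legSum (2 ℕ.* h) n)
rhsEven-legSums h n = begin
  rhsEven t n
    ≡⟨ cong₂ _+_
         (rhs-family {n = n} {Y = Y₁} {Z = Z₁} (λ k → 2 ℕ.* k ℕ.+ 1) h≤1+t (λ k → ℕₚ.≤-trans (s≤s z≤n) (ℕₚ.m≤n+m 2 (2 ℕ.* k)))
            (λ k h≤k → >⇒≤ᵇ-false (ℕₚ.≤-<-trans (2h≤6k h≤k) (ℕₚ.m<m+n _ (s≤s z≤n))))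
            (λ k k<h → rhs-block {n = n} (even-shape₁ k (h ∸ suc k) (t≡ k<h))))
         (rhs-family {n = n} {Y = Y₂} {Z = Z₂} (λ k → 2 ℕ.* k) h≤1+t (λ k → ℕₚ.m≤n+m 1 (2 ℕ.* k))
            (λ k h≤k → >⇒≤ᵇ-false (ℕₚ.≤-<-trans (2h≤6k h≤k) (ℕₚ.m<m+n _ (s≤s z≤n))))
            (λ k k<h → rhs-block {n = n} (even-shape₂ k (h ∸ suc k) (t≡ k<h)))) ⟩
  odd-legs + even-legs
    ≡⟨ ℤₚ.+-comm odd-legs even-legs ⟩
  even-legs + odd-legs
    ≡⟨ sumTo-distrib-+ h _ _ ⟨
  sumTo h (λ k → legSum t n (2 ℕ.* k) + legSum t n (2 ℕ.* k ℕ.+ 1))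
    ≡⟨ sumTo-pairs h (legSum t n) ⟨
  sumTo t (legSum t n) ∎
  where
  open ≡-Reasoning
  t = 2 ℕ.* h
  Y₁ Y₂ : ℕ → FPS
  Y₁ k = mono (t ℕ.+ 4 ℕ.* k ℕ.* k ℕ.+ 2 ℕ.* k) ⊛ qbin2 ((t ∸ 2 ℕ.* k ∸ 2) / 2) (2 ℕ.* k ℕ.+ 1)
  Y₂ k = mono (t ℕ.+ 4 ℕ.* k ℕ.* k ℕ.+ 2 ℕ.* k ℕ.+ 1) ⊛ qbin2 ((t ∸ 2 ℕ.* k ∸ 2) / 2) (2 ℕ.* k)
  Z₁ Z₂ : ℕ → ℕ → FPS
  Z₁ k m = inv (poch (negMono (2 ℕ.* m ℕ.+ 1)) 2 ((t ∸ 2 ℕ.* k) / 2))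
  Z₂ k m = inv (poch (negMono (2 ℕ.* m ℕ.+ 3)) 2 ((t ∸ 2 ℕ.* k) / 2))
  even-legs odd-legs : ℤ
  even-legs = sumTo h (λ k → legSum t n (2 ℕ.* k))
  odd-legs  = sumTo h (λ k → legSum t n (2 ℕ.* k ℕ.+ 1))
  t≡ : ∀ {k} → k < h → t ≡ 2 ℕ.* (suc k ℕ.+ (h ∸ suc k))
  t≡ k<h = cong (2 ℕ.*_) (sym (ℕₚ.m+[n∸m]≡n k<h))
  h≤1+t : h ≤ suc t
  h≤1+t = ℕₚ.≤-trans (ℕₚ.m≤m+n h (h ℕ.+ 0)) (ℕₚ.n≤1+n _)

rhsOdd-legSums : ∀ h n → rhsOdd (2 ℕ.* h ℕ.+ 1) n ≡ sumTo (2 ℕ.* h ℕ.+ 1) (legSum (2 ℕ.* h ℕ.+ 1) n)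
rhsOdd-legSums h n = begin
  rhsOdd t n
    ≡⟨ cong₂ _+_
         (rhs-family {n = n} {Y = Y₁} {Z = Z₁} (λ k → 2 ℕ.* k) (s≤s h≤t) (λ k → ℕₚ.m≤n+m 1 (2 ℕ.* k))
            (λ k 1+h≤k → >⇒≤ᵇ-false (ℕₚ.+-monoˡ-< 1 (ℕₚ.<-≤-trans (ℕₚ.*-monoʳ-< 2 (ℕₚ.n<1+n h)) (2h≤6k 1+h≤k))))
            (λ k k<1+h → rhs-block {n = n} (odd-shape₁ k (h ∸ k) (t≡₁ (ℕₚ.≤-pred k<1+h)))))
         (rhs-family {n = n} {Y = Y₂} {Z = Z₂} (λ k → 2 ℕ.* k ℕ.+ 1) (ℕₚ.≤-trans h≤t (ℕₚ.n≤1+n t)) (λ k → ℕₚ.≤-trans (s≤s z≤n) (ℕₚ.m≤n+m 2 (2 ℕ.* k)))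
            (λ k h≤k → >⇒≤ᵇ-false (ℕₚ.+-mono-≤-< (2h≤6k h≤k) (s≤s (s≤s z≤n))))
            (λ k k<h → rhs-block {n = n} (odd-shape₂ k (h ∸ suc k) (t≡₂ k<h)))) ⟩
  even-legs + legSum t n (2 ℕ.* h) + odd-legs
    ≡⟨ xy∙z≈x∙zy even-legs (legSum t n (2 ℕ.* h)) odd-legs ⟩
  even-legs + (odd-legs + legSum t n (2 ℕ.* h))
    ≡⟨ ℤₚ.+-assoc even-legs odd-legs (legSum t n (2 ℕ.* h)) ⟨
  even-legs + odd-legs + legSum t n (2 ℕ.* h)
    ≡⟨ cong (_+ legSum t n (2 ℕ.* h)) (trans (sumTo-pairs h (legSum t n)) (sumTo-distrib-+ h _ _)) ⟨
  sumTo (suc (2 ℕ.* h)) (legSum t n)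
    ≡⟨ cong (λ k → sumTo k (legSum t n)) (ℕₚ.+-comm 1 (2 ℕ.* h)) ⟩
  sumTo t (legSum t n) ∎
  where
  open ≡-Reasoning
  t = 2 ℕ.* h ℕ.+ 1
  Y₁ Y₂ : ℕ → FPS
  Y₁ k = mono (t ℕ.+ 4 ℕ.* k ℕ.* k ∸ 2 ℕ.* k) ⊛ qbin2 ((t ∸ 2 ℕ.* k ∸ 1) / 2) (2 ℕ.* k)
  Y₂ k = mono (t ℕ.+ 4 ℕ.* k ℕ.* k ℕ.+ 6 ℕ.* k ℕ.+ 3) ⊛ qbin2 ((t ∸ 2 ℕ.* k ∸ 3) / 2) (2 ℕ.* k ℕ.+ 1)
  Z₁ Z₂ : ℕ → ℕ → FPS
  Z₁ k m = inv (poch (negMono (2 ℕ.* m ℕ.+ 1)) 2 ((t ∸ 2 ℕ.* k ℕ.+ 1) / 2))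
  Z₂ k m = inv (poch (negMono (2 ℕ.* m ℕ.+ 3)) 2 ((t ∸ 2 ℕ.* k ∸ 1) / 2))
  even-legs odd-legs : ℤ
  even-legs = sumTo h (λ k → legSum t n (2 ℕ.* k))
  odd-legs  = sumTo h (λ k → legSum t n (2 ℕ.* k ℕ.+ 1))
  t≡₁ : ∀ {k} → k ≤ h → t ≡ 2 ℕ.* (k ℕ.+ (h ∸ k)) ℕ.+ 1
  t≡₁ k≤h = cong (λ x → 2 ℕ.* x ℕ.+ 1) (sym (ℕₚ.m+[n∸m]≡n k≤h))
  t≡₂ : ∀ {k} → k < h → t ≡ 2 ℕ.* (suc k ℕ.+ (h ∸ suc k)) ℕ.+ 1
  t≡₂ k<h = cong (λ x → 2 ℕ.* x ℕ.+ 1) (sym (ℕₚ.m+[n∸m]≡n k<h))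
  h≤t : h ≤ t
  h≤t = ℕₚ.≤-trans (ℕₚ.m≤m+n h (h ℕ.+ 0)) (ℕₚ.m≤m+n _ 1)

weightedGF-nHook-at-0 : ∀ t K → weightedGF (progression 1 K) (λ μ → ℤ.+ nHook t μ) 0 ≡ 0ℤ
weightedGF-nHook-at-0 t K = sumOver-zero (sublists (progression 1 K)) term≡0
  where
  term≡0 : ∀ μ → μ ∈ sublists (progression 1 K) → ℤ.+ nHook t μ * mono (sum μ) 0 ≡ 0ℤ
  term≡0 []      _  = refl
  term≡0 (x ∷ μ) μ∈ with sublists-All (progression 1 K) (progression-≥ 1 K) μ∈
  ... | 1≤x ∷ _ = trans (cong (ℤ.+ nHook t (x ∷ μ) *_) (mono-≢ (ℕₚ.<⇒≢ (ℕₚ.≤-trans 1≤x (ℕₚ.m≤m+n x (sum μ))))))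
                        (ℤₚ.*-zeroʳ (ℤ.+ nHook t (x ∷ μ)))

IsBstar-legSums : ∀ t {F} → (∀ n → F n ≡ sumTo t (legSum t n)) → IsBstar t F
IsBstar-legSums t {F} F≡ = F₀≡0 , λ n _ L L-unique L≡DO → begin
  F n                                                               ≡⟨ F≡ n ⟩
  sumTo t (legSum t n)                                              ≡⟨ weightedGF-nHook t (n<cutoff t n) ⟨
  weightedGF (progression 1 (cutoff t n)) (λ μ → ℤ.+ nHook t μ) n  ≡⟨ bstar-weightedGF t (n<cutoff t n) L L-unique L≡DO ⟨
  ℤ.+ sum (map (nHook t) L)                                         ∎
  where
  open ≡-Reasoning
  F₀≡0 : F 0 ≡ 0ℤ
  F₀≡0 = trans (F≡ 0) (trans (sym (weightedGF-nHook t (n<cutoff t 0))) (weightedGF-nHook-at-0 t (cutoff t 0)))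

theorem2p2 : (t : ℕ) → 1 ≤ t →
    (t % 2 ≡ 0 → IsBstar t (rhsEven t)) × (t % 2 ≡ 1 → IsBstar t (rhsOdd t))
theorem2p2 t _ = even , odd
  where
  t≡ : t ≡ t % 2 ℕ.+ 2 ℕ.* (t / 2)
  t≡ = trans (ℕ/.m≡m%n+[m/n]*n t 2) (cong (t % 2 ℕ.+_) (ℕₚ.*-comm (t / 2) 2))
  even : t % 2 ≡ 0 → IsBstar t (rhsEven t)
  even t%2≡0 = subst (λ t′ → IsBstar t′ (rhsEven t′)) (sym (trans t≡ (cong (ℕ._+ 2 ℕ.* (t / 2)) t%2≡0)))
                     (IsBstar-legSums _ (rhsEven-legSums (t / 2)))
  odd : t % 2 ≡ 1 → IsBstar t (rhsOdd t)
  odd t%2≡1 = subst (λ t′ → IsBstar t′ (rhsOdd t′)) (sym (trans t≡ (trans (cong (ℕ._+ 2 ℕ.* (t / 2)) t%2≡1) (ℕₚ.+-comm 1 _))))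
                    (IsBstar-legSums _ (rhsOdd-legSums (t / 2)))
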